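{- With the notation below, $$L(1,2,\dots,n)\asymp L[n^2,n]\qquad\text{and}\qquad L(\mathbf{1}^n)\asymp L[n,n]$$ as $n\to\infty$, where $\mathbf 1^n=(1,1,\dots,1)$ ($n$ entries).
   Context: Let $U_n$ be the set of $n\times n$ upper-triangular matrices $A=(a_{ij})$ with nonnegative integer entries. The $k$-th hook sum of $A$ is $h_k=\sum_{i=k}^n a_{ki}-\sum_{i=1}^{k-1}a_{ik}$. For an integer vector $\mathbf h=(h_1,\dots,h_n)$, $\mathcal T(\mathbf h)$ (the set of generalized Tesler matrices) is the set of $A\in U_n$ whose hook sum vector is $\mathbf h$, and $L(\mathbf h)=\ln|\mathcal T(\mathbf h)|$. For nonnegative integers $\eta_1,\dots,\eta_m$, let $\mathcal K[\eta_1,\dots,\eta_m]$ be the set of Kostant pictures of height $(\eta_1,\dots,\eta_m)$: finite multisets of integer intervals $[i,j]\subseteq\{1,\dots,m\}$ ($i\le j$, called loops) such that every $t\in\{1,\dots,m\}$ lies in exactly $\eta_t$ of the intervals (counted with multiplicity); equivalently, decompositions $\sum_t\eta_t\alpha_t=\sum_{i\le j}c_{ij}\alpha_{ij}$ with $c_{ij}\in\mathbb N$, where $\alpha_{ij}=e_i-e_{j+1}$ in $\mathbb R^{m+1}$ and $\alpha_t=\alpha_{tt}$. One has $|\mathcal T(\mathbf h)|=|\mathcal K[h_1,h_1+h_2,\dots,h_1+\dots+h_n]|$. For positive integers $h,w$, write $[h,w]$ for the height $(h,h,\dots,h)$ with $w$ entries, and $L[h,w]=\ln|\mathcal K[h,w]|$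 (equivalently $L[h,w]=L(h,0,\dots,0)$ with $w-1$ zeros). For positive functions $f,g$ of $n$, $f\asymp g$ means there are constants $a,b>0$ with $ag(n)\le f(n)\le bg(n)$ for all sufficiently large $n$. -}

module Defs where

open import Data.Nat using (ℕ; zero; suc; _+_; _*_; _^_; _≤_; _<_)
open import Data.Nat.Properties using (_≤?_; _<?_)
open import Data.Integer using (ℤ; +_; _-_)
open import Data.Fin using (Fin; toℕ)
open import Data.Vec using (Vec; lookup)
open import Data.List using (List; length; map; allFin)
open import Data.Nat.ListAction using (sum)
open import Data.List.Membership.Propositional using (_∈_)
open import Data.List.Relation.Unary.Unique.Propositional using (Unique)
open import Data.Product using (Σ; _×_; ∃; ∃-syntax)
open import Function.Bundles using (_⇔_)
open import Relation.Nullary.Decidable using (⌊_⌋)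
open import Data.Bool using (if_then_else_)
open import Relation.Binary.PropositionalEquality using (_≡_)

HasCard : {A : Set} → (A → Set) → ℕ → Set
HasCard {A} P k = Σ (List A) λ xs → Unique xs × (∀ x → (x ∈ xs) ⇔ P x) × length xs ≡ k

Mat : ℕ → Set
Mat n = Vec (Vec ℕ n) n

entry : ∀ {n} → Mat n → Fin n → Fin n → ℕ
entry A i j = lookup (lookup A i) j

ΣFin : ∀ n → (Fin n → ℕ) → ℕ
ΣFin n f = sum (map f (allFin n))

UpperTriangular : ∀ {n} → Mat n → Set
UpperTriangular {n} A = ∀ (i j : Fin n) → toℕ j < toℕ i → entry A i j ≡ 0

hookSum : ∀ {n} → Mat n → Fin n → ℤ
hookSum {n} A k =
  + ΣFin n (λ i → if ⌊ toℕ k ≤? toℕ i ⌋ then entry A k i else 0)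
  - + ΣFin n (λ i → if ⌊ toℕ i <? toℕ k ⌋ then entry A i k else 0)

IsTesler : ∀ {n} → (Fin n → ℤ) → Mat n → Set
IsTesler {n} h A = UpperTriangular A × (∀ k → hookSum A k ≡ h k)

-- Kostant pictures of height η = (η_1,…,η_m): multiplicities c_{ij} of loops
-- [i,j] (i ≤ j), stored as an upper-triangular m×m matrix (c_{ij} = 0 for j < i),
-- such that each t lies in exactly η_t loops counted with multiplicity.
IsKostant : ∀ {m} → (Fin m → ℕ) → Mat m → Set
IsKostant {m} η c = UpperTriangular c ×
  (∀ t → ΣFin m (λ i → ΣFin m (λ j →
      if ⌊ toℕ i ≤? toℕ t ⌋ then (if ⌊ toℕ t ≤? toℕ j ⌋ then entry c i j else 0) else 0))
    ≡ η t)

hook123 : ∀ n → Fin n → ℤ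
hook123 n k = + suc (toℕ k)

hookOnes : ∀ n → Fin n → ℤ
hookOnes n k = + 1

constHeight : ℕ → (w : ℕ) → Fin w → ℕ
constHeight h w t = h

-- f ≍ g where f n = ln X_n, g n = ln Y_n and X_n, Y_n are cardinalities given by
-- predicates F n, G n.  With real constants a,b>0 replaced by positive rationals
-- a = p/q, b = r/s (equivalent since g ≥ 0), a·ln Y ≤ ln X ≤ b·ln Y becomes
-- Y^p ≤ X^q and X^s ≤ Y^r.
LnAsymp : (ℕ → ℕ → Set) → (ℕ → ℕ → Set) → Set
LnAsymp F G =
  ∃[ p ] ∃[ q ] ∃[ r ] ∃[ s ] (1 ≤ p × 1 ≤ q × 1 ≤ r × 1 ≤ s ×
    ∃[ N ] (∀ n → N ≤ n → ∃[ X ] ∃[ Y ] (F n X × G n Y × Y ^ p ≤ X ^ q × X ^ s ≤ Y ^ r)))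

TeslerCard : ∀ n → (Fin n → ℤ) → ℕ → Set
TeslerCard n h X = HasCard (IsTesler h) X

KostantCard : ∀ m → (Fin m → ℕ) → ℕ → Set
KostantCard m η Y = HasCard (IsKostant η) Y

{-# OPTIONS --safe #-}

-- A Tesler matrix with hook sums g is the same thing as a Kostant picture of height
-- (g₁, g₁ + g₂, …): read the entry a_ij (i < j) as the loop [i, j - 1] and a_ii as the loop
-- [i, n - 1]. Viewing the entries as a flow on the vertices 0, …, n (a_ij from i to j, a_ii from
-- i to n), the hook sum at k is the net out-flow of k and the coverage of t by the picture is the
-- flow across the cut between t and t + 1, so summing hook sums gives the heights.
--
-- It remains to compare numbers #K e n of Kostant pictures. A picture is determined by its loops
-- [a, b] with a < b, subject only to every t being covered at most e t times. Hence
--   (i)   #K e n ≤ #K e′ (o + n) whenever e t ≤ e′ (o + t): place the loops at offset o;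
--   (ii)  #K[h₁ + h₂, n] ≤ #K[h₁, n] · #K[h₂, n]: fill height h₁ greedily, row by row;
--   (iii) #K[h, w₁ + w₂] ≤ #K[h, W]⁴ for w₁, w₂ < W ≤ w₁ + w₂: keep the loops inside each half,
--         and encode the at most h loops crossing the middle in two more pictures.
-- For the heights (1, 3, 6, …) resp. (1, 2, …, n) the last ⌈n/2⌉ + 1 heights are at least n²/10
-- resp. n/3, so (ii), (iii) and (i) give #K[n², n] ≤ |𝒯|⁴⁰ resp. #K[n, n] ≤ |𝒯|¹², while (i)
-- alone gives |𝒯| ≤ #K[n², n] resp. #K[n, n].

module Submission where

open import Data.Nat
  using (ℕ; zero; suc; pred; _+_; _*_; _∸_; _⊓_; _^_; _≤_; _<_; z≤n; s≤s; z<s; s<s; ⌊_/2⌋; ⌈_/2⌉)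
open import Data.Nat.Properties
open import Data.Nat.Tactic.RingSolver using (solve-∀)
open import Data.Integer using (ℤ; _-_) renaming (+_ to pos)
import Data.Integer as ℤ
import Data.Integer.Properties as ℤ
open import Data.Bool using (true; false; if_then_else_)
open import Data.Empty using (⊥-elim)
open import Data.Product using (Σ; _×_; _,_; proj₁; proj₂; ∃-syntax)
open import Data.Sum using (_⊎_; inj₁; inj₂)
open import Data.Fin using (Fin; toℕ; fromℕ<)
open import Data.Fin.Properties using (all?; toℕ<n; toℕ-fromℕ<)
open import Data.Vec using (Vec; []; _∷_; lookup)
open import Data.List
  using (List; []; _∷_; length; map; filter; cartesianProduct; cartesianProductWith; upTo; allFin; tabulate)
open import Data.List.Properties using (length-removeAt′; length-map; length-++; map-tabulate; map-cong)
open import Data.List.Membership.Propositional using (_∈_; _─_)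
open import Data.List.Membership.Propositional.Properties
  using ( ∈-filter⁺; ∈-filter⁻; ∈-cartesianProduct⁺; ∈-cartesianProduct⁻; ∈-cartesianProductWith⁺
        ; ∈-map⁺; ∈-map⁻; ∈-upTo⁺)
open import Data.List.Relation.Unary.Any using (here; there; index)
import Data.List.Relation.Unary.All as All
import Data.List.Relation.Unary.All.Properties as All
open import Data.List.Relation.Unary.AllPairs using ([]; _∷_)
open import Data.List.Relation.Unary.Unique.Propositional using (Unique)
open import Data.List.Relation.Unary.Unique.Propositional.Properties
  using (filter⁺; cartesianProduct⁺; cartesianProductWith⁺; upTo⁺)
open import Data.Nat.ListAction using (sum)
open import Function using (_∘_)
open import Function.Bundles using (_⇔_; mk⇔; Equivalence)
open import Relation.Nullary using (Dec; yes; no; ¬_)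
open import Relation.Nullary.Decidable using (⌊_⌋; _×-dec_; _→-dec_)
open import Relation.Unary using (Decidable; _⟨×⟩_)
open import Relation.Binary.PropositionalEquality
open import Relation.Binary.Definitions using (tri<; tri≈; tri>)
open import Algebra.Properties.CommutativeSemigroup +-commutativeSemigroup
  using (interchange; xy∙z≈xz∙y; xy∙z≈x∙zy)
open import Defs

∑< : ℕ → (ℕ → ℕ) → ℕ
∑< zero    f = 0
∑< (suc n) f = f 0 + ∑< n (f ∘ suc)

syntax ∑< n (λ i → e) = ∑[ i < n ] e

∑<-cong : ∀ n {f g : ℕ → ℕ} → (∀ i → i < n → f i ≡ g i) → ∑< n f ≡ ∑< n g
∑<-cong zero    eq = refl
∑<-cong (suc n) eq = cong₂ _+_ (eq 0 z<s) (∑<-cong n (λ i i<n → eq (suc i) (s<s i<n)))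

∑<-mono : ∀ n {f g : ℕ → ℕ} → (∀ i → i < n → f i ≤ g i) → ∑< n f ≤ ∑< n g
∑<-mono zero    le = z≤n
∑<-mono (suc n) le = +-mono-≤ (le 0 z<s) (∑<-mono n (λ i i<n → le (suc i) (s<s i<n)))

∑<-zero : ∀ n {f : ℕ → ℕ} → (∀ i → i < n → f i ≡ 0) → ∑< n f ≡ 0
∑<-zero zero    eq = refl
∑<-zero (suc n) eq = cong₂ _+_ (eq 0 z<s) (∑<-zero n (λ i i<n → eq (suc i) (s<s i<n)))

∑<-term : ∀ n (f : ℕ → ℕ) {i} → i < n → f i ≤ ∑< n f
∑<-term (suc n) f {zero}  _         = m≤m+n (f 0) _
∑<-term (suc n) f {suc i} (s≤s i<n) = ≤-trans (∑<-term n (f ∘ suc) i<n) (m≤n+m _ (f 0))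

∑<-const : ∀ n c → ∑[ _ < n ] c ≡ n * c
∑<-const zero    c = refl
∑<-const (suc n) c = cong (c +_) (∑<-const n c)

∑<-distrib-+ : ∀ n (f g : ℕ → ℕ) → ∑[ i < n ] (f i + g i) ≡ ∑< n f + ∑< n g
∑<-distrib-+ zero    f g = refl
∑<-distrib-+ (suc n) f g =
  trans (cong (f 0 + g 0 +_) (∑<-distrib-+ n (f ∘ suc) (g ∘ suc)))
        (interchange (f 0) (g 0) (∑< n (f ∘ suc)) (∑< n (g ∘ suc)))

∑<-swap : ∀ m n (f : ℕ → ℕ → ℕ) → ∑[ i < m ] ∑[ j < n ] f i j ≡ ∑[ j < n ] ∑[ i < m ] f i j
∑<-swap zero    n f = sym (∑<-zero n (λ _ _ → refl))
∑<-swap (suc m) n f =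
  trans (cong (∑[ j < n ] f 0 j +_) (∑<-swap m n (f ∘ suc)))
        (sym (∑<-distrib-+ n (f 0) (λ j → ∑[ i < m ] f (suc i) j)))

∑<-split : ∀ m n (f : ℕ → ℕ) → ∑< (m + n) f ≡ ∑< m f + ∑[ i < n ] f (m + i)
∑<-split zero    n f = refl
∑<-split (suc m) n f = trans (cong (f 0 +_) (∑<-split m n (f ∘ suc))) (sym (+-assoc (f 0) _ _))

∑<-suc : ∀ n (f : ℕ → ℕ) → ∑< (suc n) f ≡ ∑< n f + f n
∑<-suc zero    f = +-comm (f 0) 0
∑<-suc (suc n) f = trans (cong (f 0 +_) (∑<-suc n (f ∘ suc))) (sym (+-assoc (f 0) _ _))

∑<-single : ∀ n (f : ℕ → ℕ) {t} → t < n → (∀ i → i < n → i ≢ t → f i ≡ 0) → ∑< n f ≡ f t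
∑<-single (suc n) f {zero} _ off =
  trans (cong (f 0 +_) (∑<-zero n (λ i i<n → off (suc i) (s<s i<n) (λ ())))) (+-identityʳ _)
∑<-single (suc n) f {suc t} (s≤s t<n) off =
  cong₂ _+_ (off 0 z<s (λ ()))
            (∑<-single n (f ∘ suc) t<n (λ i i<n i≢t → off (suc i) (s<s i<n) (i≢t ∘ suc-injective)))

∑<-vanishing-tail : ∀ {m n} (f : ℕ → ℕ) → m ≤ n → (∀ i → m ≤ i → i < n → f i ≡ 0) → ∑< n f ≡ ∑< m f
∑<-vanishing-tail {m} {n} f m≤n tail = begin
  ∑< n f                                ≡⟨ cong (λ k → ∑< k f) (m+[n∸m]≡n m≤n) ⟨
  ∑< (m + (n ∸ m)) f                    ≡⟨ ∑<-split m (n ∸ m) f ⟩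
  ∑< m f + ∑[ i < n ∸ m ] f (m + i)     ≡⟨ cong (∑< m f +_) (∑<-zero (n ∸ m) tail-zero) ⟩
  ∑< m f + 0                            ≡⟨ +-identityʳ _ ⟩
  ∑< m f                                ∎
  where
  open ≡-Reasoning
  tail-zero : ∀ i → i < n ∸ m → f (m + i) ≡ 0
  tail-zero i i<n∸m =
    tail (m + i) (m≤m+n m i) (subst (m + i <_) (m+[n∸m]≡n m≤n) (+-monoʳ-< m i<n∸m))

∑<-mono-range : ∀ {m n} (f : ℕ → ℕ) → m ≤ n → ∑< m f ≤ ∑< n f
∑<-mono-range {m} {n} f m≤n = begin
  ∑< m f                             ≤⟨ m≤m+n (∑< m f) _ ⟩
  ∑< m f + ∑[ i < n ∸ m ] f (m + i)  ≡⟨ ∑<-split m (n ∸ m) f ⟨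
  ∑< (m + (n ∸ m)) f                 ≡⟨ cong (λ k → ∑< k f) (m+[n∸m]≡n m≤n) ⟩
  ∑< n f                             ∎
  where open ≤-Reasoning

∑<-prefixes-injective : ∀ n {f g : ℕ → ℕ} →
  (∀ t → t < n → ∑< (suc t) f ≡ ∑< (suc t) g) → ∀ k → k < n → f k ≡ g k
∑<-prefixes-injective n {f} {g} eq zero    0<n   = +-cancelʳ-≡ 0 (f 0) (g 0) (eq 0 0<n)
∑<-prefixes-injective n {f} {g} eq (suc k) 1+k<n =
  +-cancelˡ-≡ (∑< (suc k) f) (f (suc k)) (g (suc k)) (begin
    ∑< (suc k) f + f (suc k)  ≡⟨ ∑<-suc (suc k) f ⟨
    ∑< (suc (suc k)) f        ≡⟨ eq (suc k) 1+k<n ⟩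
    ∑< (suc (suc k)) g        ≡⟨ ∑<-suc (suc k) g ⟩
    ∑< (suc k) g + g (suc k)  ≡⟨ cong (_+ g (suc k)) (eq k (<-trans (n<1+n k) 1+k<n)) ⟨
    ∑< (suc k) f + g (suc k)  ∎)
  where open ≡-Reasoning

ΣFin≡∑< : ∀ n {f : Fin n → ℕ} (g : ℕ → ℕ) → (∀ i → f i ≡ g (toℕ i)) → ΣFin n f ≡ ∑< n g
ΣFin≡∑< n g eq =
  trans (cong sum (trans (map-cong eq (allFin n)) (map-tabulate (λ i → i) (g ∘ toℕ))))
        (sum-tabulate n g)
  where
  sum-tabulate : ∀ n (g : ℕ → ℕ) → sum (tabulate {n = n} (g ∘ toℕ)) ≡ ∑< n g
  sum-tabulate zero    g = refl
  sum-tabulate (suc n) g = cong (g 0 +_) (sum-tabulate n (g ∘ suc))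

vecAt : ∀ {n} → Vec ℕ n → ℕ → ℕ
vecAt []       _       = 0
vecAt (x ∷ xs) zero    = x
vecAt (x ∷ xs) (suc j) = vecAt xs j

matAt : ∀ {m n} → Vec (Vec ℕ n) m → ℕ → ℕ → ℕ
matAt []       _       _ = 0
matAt (r ∷ rs) zero    j = vecAt r j
matAt (r ∷ rs) (suc i) j = matAt rs i j

vecFrom : ∀ n → (ℕ → ℕ) → Vec ℕ n
vecFrom zero    f = []
vecFrom (suc n) f = f 0 ∷ vecFrom n (f ∘ suc)

matFrom : ∀ m n → (ℕ → ℕ → ℕ) → Vec (Vec ℕ n) m
matFrom zero    n F = []
matFrom (suc m) n F = vecFrom n (F 0) ∷ matFrom m n (F ∘ suc)

matAt-entry : ∀ {n} (c : Mat n) (i j : Fin n) → entry c i j ≡ matAt c (toℕ i) (toℕ j)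
matAt-entry c i j = sym (trans (matAt-lookup c i) (vecAt-lookup (lookup c i) j))
  where
  vecAt-lookup : ∀ {n} (xs : Vec ℕ n) (j : Fin n) → vecAt xs (toℕ j) ≡ lookup xs j
  vecAt-lookup (x ∷ xs) Fin.zero    = refl
  vecAt-lookup (x ∷ xs) (Fin.suc j) = vecAt-lookup xs j
  matAt-lookup : ∀ {m n} (rs : Vec (Vec ℕ n) m) (i : Fin m) {j} → matAt rs (toℕ i) j ≡ vecAt (lookup rs i) j
  matAt-lookup (r ∷ rs) Fin.zero    = refl
  matAt-lookup (r ∷ rs) (Fin.suc i) = matAt-lookup rs i

matAt-row-outside : ∀ {m n} (rs : Vec (Vec ℕ n) m) {i} j → m ≤ i → matAt rs i j ≡ 0
matAt-row-outside []       j _         = refl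
matAt-row-outside (r ∷ rs) j (s≤s m≤i) = matAt-row-outside rs j m≤i

matAt-col-outside : ∀ {m n} (rs : Vec (Vec ℕ n) m) i {j} → n ≤ j → matAt rs i j ≡ 0
matAt-col-outside []       i       n≤j = refl
matAt-col-outside (r ∷ rs) zero    n≤j = vecAt-outside r n≤j
  where
  vecAt-outside : ∀ {n} (xs : Vec ℕ n) {j} → n ≤ j → vecAt xs j ≡ 0
  vecAt-outside []       _         = refl
  vecAt-outside (x ∷ xs) (s≤s n≤j) = vecAt-outside xs n≤j
matAt-col-outside (r ∷ rs) (suc i) n≤j = matAt-col-outside rs i n≤j

matAt-matFrom : ∀ m n F {i j} → i < m → j < n → matAt (matFrom m n F) i j ≡ F i j
matAt-matFrom (suc m) n F {zero}  _         j<n = vecAt-vecFrom n (F 0) j<n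
  where
  vecAt-vecFrom : ∀ n f {j} → j < n → vecAt (vecFrom n f) j ≡ f j
  vecAt-vecFrom (suc n) f {zero}  _         = refl
  vecAt-vecFrom (suc n) f {suc j} (s≤s j<n) = vecAt-vecFrom n (f ∘ suc) j<n
matAt-matFrom (suc m) n F {suc i} (s≤s i<m) j<n = matAt-matFrom m n (F ∘ suc) i<m j<n

matAt-injective : ∀ {m n} (rs ss : Vec (Vec ℕ n) m) →
                  (∀ i j → i < m → j < n → matAt rs i j ≡ matAt ss i j) → rs ≡ ss
matAt-injective []       []       eq = refl
matAt-injective (r ∷ rs) (s ∷ ss) eq =
  cong₂ _∷_ (vecAt-injective r s (λ j → eq 0 j z<s))
            (matAt-injective rs ss (λ i j i<m → eq (suc i) j (s<s i<m)))
  where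
  vecAt-injective : ∀ {n} (xs ys : Vec ℕ n) → (∀ j → j < n → vecAt xs j ≡ vecAt ys j) → xs ≡ ys
  vecAt-injective []       []       eq = refl
  vecAt-injective (x ∷ xs) (y ∷ ys) eq =
    cong₂ _∷_ (eq 0 z<s) (vecAt-injective xs ys (λ j j<n → eq (suc j) (s<s j<n)))

matFrom-upperTriangular : ∀ n F → (∀ i j → j < i → F i j ≡ 0) → UpperTriangular (matFrom n n F)
matFrom-upperTriangular n F lower-zero i j j<i =
  trans (matAt-entry (matFrom n n F) i j)
        (trans (matAt-matFrom n n F (toℕ<n i) (toℕ<n j)) (lower-zero (toℕ i) (toℕ j) j<i))

if-yes : ∀ {A : Set} (d : Dec A) {x y : ℕ} → A → (if ⌊ d ⌋ then x else y) ≡ x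
if-yes (yes _) _ = refl
if-yes (no ¬a) a = ⊥-elim (¬a a)

if-no : ∀ {A : Set} (d : Dec A) {x y : ℕ} → ¬ A → (if ⌊ d ⌋ then x else y) ≡ y
if-no (yes a) ¬a = ⊥-elim (¬a a)
if-no (no _)  _  = refl

if-≡0 : ∀ c {x : ℕ} → x ≡ 0 → (if c then x else 0) ≡ 0
if-≡0 true  x≡0 = x≡0
if-≡0 false _   = refl

if-≤ : ∀ c (x : ℕ) → (if c then x else 0) ≤ x
if-≤ true  x = ≤-refl
if-≤ false x = z≤n

-- F a b is the multiplicity of the loop [a, b]; only a ≤ b is ever read.
Loops : Set
Loops = ℕ → ℕ → ℕ

through : ℕ → Loops → Loops
through t F a b = if ⌊ a ≤? t ⌋ then (if ⌊ t ≤? b ⌋ then F a b else 0) else 0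

coverage : ℕ → Loops → ℕ → ℕ
coverage n F t = ∑[ a < n ] ∑[ b < n ] through t F a b

strictUpper : Loops → Loops
strictUpper F a b = if ⌊ a <? b ⌋ then F a b else 0

through-inside : ∀ {t a b} F → a ≤ t → t ≤ b → through t F a b ≡ F a b
through-inside {t} {a} {b} F a≤t t≤b = trans (if-yes (a ≤? t) a≤t) (if-yes (t ≤? b) t≤b)

through-left : ∀ {t} F a b → t < a → through t F a b ≡ 0
through-left {t} F a b t<a = if-no (a ≤? t) (<⇒≱ t<a)

through-right : ∀ {t} F a b → b < t → through t F a b ≡ 0
through-right {t} F a b b<t = if-≡0 ⌊ a ≤? t ⌋ (if-no (t ≤? b) (<⇒≱ b<t))

through-zero : ∀ {t} F a b → (a ≤ t → t ≤ b → F a b ≡ 0) → through t F a b ≡ 0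
through-zero {t} F a b eq with a ≤? t | t ≤? b
... | yes a≤t | yes t≤b = eq a≤t t≤b
... | yes _   | no _    = refl
... | no _    | _       = refl

through-cong : ∀ {t a b} {F G : Loops} → (a ≤ t → t ≤ b → F a b ≡ G a b) → through t F a b ≡ through t G a b
through-cong {t} {a} {b} eq with a ≤? t | t ≤? b
... | yes a≤t | yes t≤b = eq a≤t t≤b
... | yes _   | no _    = refl
... | no _    | _       = refl

through-mono : ∀ {t a b} {F G : Loops} → (a ≤ t → t ≤ b → F a b ≤ G a b) → through t F a b ≤ through t G a b
through-mono {t} {a} {b} le with a ≤? t | t ≤? b
... | yes a≤t | yes t≤b = le a≤t t≤b
... | yes _   | no _    = z≤n
... | no _    | _       = z≤n

through-≤ : ∀ t F a b → through t F a b ≤ F a b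
through-≤ t F a b = ≤-trans (if-≤ ⌊ a ≤? t ⌋ _) (if-≤ ⌊ t ≤? b ⌋ (F a b))

strictUpper-above : ∀ F {a b} → a < b → strictUpper F a b ≡ F a b
strictUpper-above F {a} {b} a<b = if-yes (a <? b) a<b

strictUpper-below : ∀ F {a b} → b ≤ a → strictUpper F a b ≡ 0
strictUpper-below F {a} {b} b≤a = if-no (a <? b) (≤⇒≯ b≤a)

strictUpper-≤ : ∀ F a b → strictUpper F a b ≤ F a b
strictUpper-≤ F a b = if-≤ ⌊ a <? b ⌋ (F a b)

strictUpper-≡0 : ∀ F a b → F a b ≡ 0 → strictUpper F a b ≡ 0
strictUpper-≡0 F a b = if-≡0 ⌊ a <? b ⌋

strictUpper-mono : ∀ {F G : Loops} a b → F a b ≤ G a b → strictUpper F a b ≤ strictUpper G a b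
strictUpper-mono a b le with a <? b
... | yes _ = le
... | no _  = z≤n

coverage-cong : ∀ n t {F G : Loops} → (∀ a b → a ≤ t → t ≤ b → b < n → F a b ≡ G a b) →
                coverage n F t ≡ coverage n G t
coverage-cong n t {F} {G} eq =
  ∑<-cong n (λ a _ → ∑<-cong n (λ b b<n → through-cong {F = F} {G} (λ a≤t t≤b → eq a b a≤t t≤b b<n)))

coverage-mono : ∀ n t {F G : Loops} → (∀ a b → a ≤ t → t ≤ b → b < n → F a b ≤ G a b) →
                coverage n F t ≤ coverage n G t
coverage-mono n t {F} {G} le =
  ∑<-mono n (λ a _ → ∑<-mono n (λ b b<n → through-mono {F = F} {G} (λ a≤t t≤b → le a b a≤t t≤b b<n)))

coverage-zero : ∀ n F t → (∀ a b → a ≤ t → t ≤ b → b < n → F a b ≡ 0) → coverage n F t ≡ 0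
coverage-zero n F t eq =
  ∑<-zero n (λ a _ → ∑<-zero n (λ b b<n → through-zero F a b (λ a≤t t≤b → eq a b a≤t t≤b b<n)))

coverage-≤-total : ∀ n F t → coverage n F t ≤ ∑[ a < n ] ∑[ b < n ] F a b
coverage-≤-total n F t = ∑<-mono n (λ a _ → ∑<-mono n (λ b _ → through-≤ t F a b))

coverage-+ : ∀ n F G t → coverage n (λ a b → F a b + G a b) t ≡ coverage n F t + coverage n G t
coverage-+ n F G t =
  trans (∑<-cong n (λ a _ → trans (∑<-cong n (λ b _ → through-+ a b)) (∑<-distrib-+ n _ _)))
        (∑<-distrib-+ n _ _)
  where
  through-+ : ∀ a b → through t (λ a b → F a b + G a b) a b ≡ through t F a b + through t G a b
  through-+ a b with a ≤? t | t ≤? b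
  ... | yes _ | yes _ = refl
  ... | yes _ | no _  = refl
  ... | no _  | _     = refl

coverage-diagonal : ∀ n F {t} → t < n → coverage n F t ≡ F t t + coverage n (strictUpper F) t
coverage-diagonal n F {t} t<n = begin
  coverage n F t                                            ≡⟨ coverage-cong n t (λ a b _ _ _ → split a b) ⟩
  coverage n (λ a b → nonstrict a b + strictUpper F a b) t  ≡⟨ coverage-+ n nonstrict (strictUpper F) t ⟩
  coverage n nonstrict t + coverage n (strictUpper F) t     ≡⟨ cong (_+ coverage n (strictUpper F) t)
                                                                    nonstrict-coverage ⟩
  F t t + coverage n (strictUpper F) t                      ∎
  where
  open ≡-Reasoning
  nonstrict : Loops
  nonstrict a b = if ⌊ a <? b ⌋ then 0 else F a b
  split : ∀ a b → F a b ≡ nonstrict a b + strictUpper F a b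
  split a b with a <? b
  ... | yes _ = refl
  ... | no _  = sym (+-identityʳ _)
  off-diagonal : ∀ a b → a ≢ t ⊎ b ≢ t → through t nonstrict a b ≡ 0
  off-diagonal a b ne = through-zero nonstrict a b (λ a≤t t≤b → if-yes (a <? b) (a<b a≤t t≤b ne))
    where
    a<b : a ≤ t → t ≤ b → a ≢ t ⊎ b ≢ t → a < b
    a<b a≤t t≤b (inj₁ a≢t) = <-≤-trans (≤∧≢⇒< a≤t a≢t) t≤b
    a<b a≤t t≤b (inj₂ b≢t) = ≤-<-trans a≤t (≤∧≢⇒< t≤b (b≢t ∘ sym))
  nonstrict-coverage : coverage n nonstrict t ≡ F t t
  nonstrict-coverage = begin
    coverage n nonstrict t              ≡⟨ ∑<-single n _ t<n (λ a _ a≢t → ∑<-zero n (λ b _ →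
                                             off-diagonal a b (inj₁ a≢t))) ⟩
    ∑[ b < n ] through t nonstrict t b  ≡⟨ ∑<-single n _ t<n (λ b _ b≢t → off-diagonal t b (inj₂ b≢t)) ⟩
    through t nonstrict t t             ≡⟨ through-inside nonstrict ≤-refl ≤-refl ⟩
    nonstrict t t                       ≡⟨ if-no (t <? t) (<-irrefl refl) ⟩
    F t t                               ∎

shift : ℕ → Loops → Loops
shift o F a b = F (o + a) (o + b)

through-shift : ∀ o t F a b → through (o + t) F (o + a) (o + b) ≡ through t (shift o F) a b
through-shift o t F a b with a ≤? t | t ≤? b
... | yes a≤t | yes t≤b = through-inside F (+-monoʳ-≤ o a≤t) (+-monoʳ-≤ o t≤b)
... | yes _   | no t≰b  = through-right F (o + a) (o + b) (+-monoʳ-< o (≰⇒> t≰b))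
... | no a≰t  | _       = through-left F (o + a) (o + b) (+-monoʳ-< o (≰⇒> a≰t))

strictUpper-shift : ∀ o F a b → strictUpper (shift o F) a b ≡ shift o (strictUpper F) a b
strictUpper-shift o F a b with <-≤-connex a b
... | inj₁ a<b = trans (strictUpper-above (shift o F) a<b) (sym (strictUpper-above F (+-monoʳ-< o a<b)))
... | inj₂ b≤a = trans (strictUpper-below (shift o F) b≤a) (sym (strictUpper-below F (+-monoʳ-≤ o b≤a)))

coverage-offset : ∀ o W F t → coverage (o + W) F (o + t) ≡
  ∑[ a < o ] ∑[ b < o + W ] through (o + t) F a b + coverage W (shift o F) t
coverage-offset o W F t =
  trans (∑<-split o W _) (cong (∑[ a < o ] ∑[ b < o + W ] through (o + t) F a b +_) (∑<-cong W row))
  where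
  row : ∀ a → a < W → ∑[ b < o + W ] through (o + t) F (o + a) b ≡ ∑[ b < W ] through t (shift o F) a b
  row a _ = trans (∑<-split o W _)
                  (cong₂ _+_ (∑<-zero o (λ b b<o → through-right F (o + a) b (<-≤-trans b<o (m≤m+n o t))))
                             (∑<-cong W (λ b _ → through-shift o t F a b)))

coverage-shift-≤ : ∀ o W F t → coverage W (shift o F) t ≤ coverage (o + W) F (o + t)
coverage-shift-≤ o W F t = subst (coverage W (shift o F) t ≤_) (sym (coverage-offset o W F t)) (m≤n+m _ _)

coverage-shift : ∀ o W F t → (∀ a b → a < o → F a b ≡ 0) →
                 coverage (o + W) F (o + t) ≡ coverage W (shift o F) t
coverage-shift o W F t low =
  trans (coverage-offset o W F t)
        (cong (_+ coverage W (shift o F) t)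
              (∑<-zero o (λ a a<o → ∑<-zero (o + W) (λ b _ → through-zero F a b (λ _ _ → low a b a<o)))))

coverage-narrow : ∀ {k m} G t → k ≤ m → (∀ a b → k ≤ b → G a b ≡ 0) → coverage m G t ≡ coverage k G t
coverage-narrow {k} {m} G t k≤m high =
  trans (∑<-cong m (λ a _ → ∑<-vanishing-tail (through t G a) k≤m (λ b k≤b _ → beyond a b k≤b)))
        (∑<-vanishing-tail _ k≤m (λ a k≤a _ → ∑<-zero k (λ b _ → through-zero G a b (λ a≤t t≤b →
          high a b (≤-trans k≤a (≤-trans a≤t t≤b))))))
  where
  beyond : ∀ a b → k ≤ b → through t G a b ≡ 0
  beyond a b k≤b = through-zero G a b (λ _ _ → high a b k≤b)

entering : ℕ → Loops → ℕ → ℕ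
entering n G t = ∑[ i < t ] ∑[ j < n ] (if ⌊ t ≤? j ⌋ then G i j else 0)

rowSum : ℕ → Loops → ℕ → ℕ
rowSum n G t = ∑[ j < n ] strictUpper G t j

colSum : ℕ → Loops → ℕ → ℕ
colSum n G t = ∑[ i < n ] strictUpper G i t

coverage-entering+rowSum : ∀ n G {t} → t < n →
  coverage n (strictUpper G) t ≡ entering n G t + rowSum n G t
coverage-entering+rowSum n G {t} t<n = begin
  coverage n (strictUpper G) t                        ≡⟨ ∑<-vanishing-tail _ t<n (λ a t<a _ → ∑<-zero n (λ b _ →
                                                           through-left (strictUpper G) a b t<a)) ⟩
  ∑[ a < suc t ] ∑[ b < n ] row a b                   ≡⟨ ∑<-suc t _ ⟩
  ∑[ a < t ] ∑[ b < n ] row a b + ∑[ b < n ] row t b  ≡⟨ cong₂ _+_ (∑<-cong t (λ a a<t → ∑<-cong n (λ b _ →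
                                                                      before a b a<t)))
                                                                   (∑<-cong n (λ b _ → at b)) ⟩
  entering n G t + rowSum n G t                       ∎
  where
  open ≡-Reasoning
  row : Loops
  row = through t (strictUpper G)
  before : ∀ a b → a < t → row a b ≡ (if ⌊ t ≤? b ⌋ then G a b else 0)
  before a b a<t with ≤-<-connex t b
  ... | inj₁ t≤b = trans (through-inside (strictUpper G) (<⇒≤ a<t) t≤b)
                         (trans (strictUpper-above G (<-≤-trans a<t t≤b)) (sym (if-yes (t ≤? b) t≤b)))
  ... | inj₂ b<t = trans (through-right (strictUpper G) a b b<t) (sym (if-no (t ≤? b) (<⇒≱ b<t)))
  at : ∀ b → row t b ≡ strictUpper G t b
  at b with ≤-<-connex t b
  ... | inj₁ t≤b = through-inside (strictUpper G) ≤-refl t≤b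
  ... | inj₂ b<t = trans (through-right (strictUpper G) t b b<t) (sym (strictUpper-below G (<⇒≤ b<t)))

coverage-entering+colSum : ∀ n G {t} → t < n →
  coverage n (strictUpper G) t ≡ entering n G (suc t) + colSum n G t
coverage-entering+colSum n G {t} t<n = begin
  coverage n (strictUpper G) t
    ≡⟨ ∑<-vanishing-tail _ t<n (λ a t<a _ → ∑<-zero n (λ b _ → through-left (strictUpper G) a b t<a)) ⟩
  ∑[ a < suc t ] ∑[ b < n ] row a b
    ≡⟨ ∑<-cong (suc t) (λ a a≤t → trans (∑<-cong n (λ b _ → split a b (≤-pred a≤t)))
                                         (∑<-distrib-+ n (leaving a) (ending a))) ⟩
  ∑[ a < suc t ] (∑[ b < n ] leaving a b + ∑[ b < n ] ending a b)
    ≡⟨ ∑<-distrib-+ (suc t) (λ a → ∑< n (leaving a)) (λ a → ∑< n (ending a)) ⟩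
  entering n G (suc t) + ∑[ a < suc t ] ∑[ b < n ] ending a b
    ≡⟨ cong (entering n G (suc t) +_) (∑<-cong (suc t) (λ a _ → ending-at-t a)) ⟩
  entering n G (suc t) + ∑[ a < suc t ] strictUpper G a t
    ≡⟨ cong (entering n G (suc t) +_)
            (∑<-vanishing-tail (λ a → strictUpper G a t) t<n (λ a t<a _ → strictUpper-below G (<⇒≤ t<a))) ⟨
  entering n G (suc t) + colSum n G t
    ∎
  where
  open ≡-Reasoning
  row leaving ending : Loops
  row         = through t (strictUpper G)
  leaving a b = if ⌊ suc t ≤? b ⌋ then G a b else 0
  ending  a b = if ⌊ b ≟ t ⌋ then strictUpper G a b else 0
  ending-at-t : ∀ a → ∑< n (ending a) ≡ strictUpper G a t
  ending-at-t a = trans (∑<-single n (ending a) t<n (λ b _ b≢t → if-no (b ≟ t) b≢t)) (if-yes (t ≟ t) refl)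
  split : ∀ a b → a ≤ t → row a b ≡ leaving a b + ending a b
  split a b a≤t with <-cmp b t
  ... | tri< b<t _ _  = trans (through-right (strictUpper G) a b b<t)
                              (sym (cong₂ _+_ (if-no (suc t ≤? b) (<⇒≱ (<-trans b<t (n<1+n t))))
                                              (if-no (b ≟ t) (<⇒≢ b<t))))
  ... | tri≈ _ refl _ = trans (through-inside (strictUpper G) a≤t ≤-refl)
                              (sym (cong₂ _+_ (if-no (suc t ≤? t) (<-irrefl refl)) (if-yes (t ≟ t) refl)))
  ... | tri> _ _ t<b  = trans (through-inside (strictUpper G) a≤t (<⇒≤ t<b))
                        (trans (strictUpper-above G (≤-<-trans a≤t t<b))
                        (sym (trans (cong₂ _+_ (if-yes (suc t ≤? b) t<b) (if-no (b ≟ t) (>⇒≢ t<b)))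
                                    (+-identityʳ _))))

entering-suc-≤ : ∀ n G {t} → t < n → entering n G (suc t) ≤ coverage n (strictUpper G) t
entering-suc-≤ n G {t} t<n = begin
  entering n G (suc t)                 ≤⟨ m≤m+n _ (colSum n G t) ⟩
  entering n G (suc t) + colSum n G t  ≡⟨ coverage-entering+colSum n G t<n ⟨
  coverage n (strictUpper G) t         ∎
  where open ≤-Reasoning

entering-step : ∀ N G {t} → t < N → entering N G t + rowSum N G t ≡ entering N G (suc t) + colSum N G t
entering-step N G t<N = trans (sym (coverage-entering+rowSum N G t<N)) (coverage-entering+colSum N G t<N)

flow-cut : ∀ N G t → t ≤ N → ∑< t (rowSum N G) ≡ entering N G t + ∑< t (colSum N G)
flow-cut N G zero    _   = refl
flow-cut N G (suc t) t<N = begin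
  ∑< (suc t) (rowSum N G)                                    ≡⟨ ∑<-suc t (rowSum N G) ⟩
  ∑< t (rowSum N G) + rowSum N G t                           ≡⟨ cong (_+ rowSum N G t) (flow-cut N G t (<⇒≤ t<N)) ⟩
  entering N G t + ∑< t (colSum N G) + rowSum N G t          ≡⟨ xy∙z≈xz∙y (entering N G t) _ _ ⟩
  entering N G t + rowSum N G t + ∑< t (colSum N G)          ≡⟨ cong (_+ ∑< t (colSum N G))
                                                                     (entering-step N G t<N) ⟩
  entering N G (suc t) + colSum N G t + ∑< t (colSum N G)    ≡⟨ xy∙z≈x∙zy (entering N G (suc t)) _ _ ⟩
  entering N G (suc t) + (∑< t (colSum N G) + colSum N G t)  ≡⟨ cong (entering N G (suc t) +_) (∑<-suc t _) ⟨
  entering N G (suc t) + ∑< (suc t) (colSum N G)             ∎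
  where open ≡-Reasoning

∈-─ : ∀ {A : Set} {x z : A} {ys} (x∈ys : x ∈ ys) → z ∈ ys → z ≢ x → z ∈ ys ─ x∈ys
∈-─ (here refl)  (here refl)  z≢x = ⊥-elim (z≢x refl)
∈-─ (here refl)  (there z∈ys) _   = z∈ys
∈-─ (there _)    (here refl)  _   = here refl
∈-─ (there x∈ys) (there z∈ys) z≢x = there (∈-─ x∈ys z∈ys z≢x)

module _ {A B : Set} (f : A → B) where

  length-≤-injection : ∀ {xs ys} → Unique xs → (∀ {x} → x ∈ xs → f x ∈ ys) →
    (∀ {x y} → x ∈ xs → y ∈ xs → f x ≡ f y → x ≡ y) → length xs ≤ length ys
  length-≤-injection {[]}     _                 _    _   = z≤n
  length-≤-injection {x ∷ xs} {ys} (x∉xs ∷ unique) into inj = begin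
    suc (length xs)            ≤⟨ s≤s (length-≤-injection unique into-rest (λ p q → inj (there p) (there q))) ⟩
    suc (length (ys ─ fx∈ys))  ≡⟨ length-removeAt′ ys (index fx∈ys) ⟨
    length ys                  ∎
    where
    open ≤-Reasoning
    fx∈ys : f x ∈ ys
    fx∈ys = into (here refl)
    into-rest : ∀ {y} → y ∈ xs → f y ∈ ys ─ fx∈ys
    into-rest y∈xs =
      ∈-─ fx∈ys (into (there y∈xs)) (λ eq → All.lookup x∉xs y∈xs (sym (inj (there y∈xs) (here refl) eq)))

  map-unique : ∀ {xs} → Unique xs → (∀ {x y} → x ∈ xs → y ∈ xs → f x ≡ f y → x ≡ y) → Unique (map f xs)
  map-unique {[]}     []              _   = []
  map-unique {x ∷ xs} (x∉xs ∷ unique) inj =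
    All.map⁺ (All.tabulate (λ y∈xs eq → All.lookup x∉xs y∈xs (inj (here refl) (there y∈xs) eq)))
    ∷ map-unique unique (λ p q → inj (there p) (there q))

module _ {A B : Set} {P : A → Set} {Q : B → Set} {k l : ℕ} where

  HasCard-≤ : HasCard P k → HasCard Q l → (f : A → B) →
    (∀ {x} → P x → Q (f x)) → (∀ {x y} → P x → P y → f x ≡ f y → x ≡ y) → k ≤ l
  HasCard-≤ (xs , unique , xs↔P , refl) (ys , _ , ys↔Q , refl) f maps inj =
    length-≤-injection f unique
      (λ {x} x∈xs → Equivalence.from (ys↔Q (f x)) (maps (Equivalence.to (xs↔P x) x∈xs)))
      (λ {x} {y} x∈xs y∈xs → inj (Equivalence.to (xs↔P x) x∈xs) (Equivalence.to (xs↔P y) y∈xs))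

  HasCard-× : HasCard P k → HasCard Q l → HasCard (P ⟨×⟩ Q) (k * l)
  HasCard-× (xs , uxs , xs↔P , refl) (ys , uys , ys↔Q , refl) =
    cartesianProduct xs ys , cartesianProduct⁺ uxs uys , membership , length-cartesianProduct xs
    where
    membership : ∀ p → p ∈ cartesianProduct xs ys ⇔ (P ⟨×⟩ Q) p
    membership (x , y) = mk⇔
      (λ p∈ → let x∈ , y∈ = ∈-cartesianProduct⁻ xs ys p∈ in
              Equivalence.to (xs↔P x) x∈ , Equivalence.to (ys↔Q y) y∈)
      (λ (px , qy) → ∈-cartesianProduct⁺ (Equivalence.from (xs↔P x) px) (Equivalence.from (ys↔Q y) qy))
    length-cartesianProduct : ∀ xs → length (cartesianProduct xs ys) ≡ length xs * length ys
    length-cartesianProduct []       = refl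
    length-cartesianProduct (x ∷ xs) =
      trans (length-++ (map (x ,_) ys)) (cong₂ _+_ (length-map (x ,_) ys) (length-cartesianProduct xs))

module _ {A B : Set} {P : A → Set} {Q : B → Set} {k : ℕ} where

  HasCard-bijection : HasCard P k → (f : A → B) (g : B → A) →
    (∀ {x} → P x → Q (f x)) → (∀ {y} → Q y → P (g y)) →
    (∀ {x} → P x → g (f x) ≡ x) → (∀ {y} → Q y → f (g y) ≡ y) → HasCard Q k
  HasCard-bijection (xs , unique , xs↔P , refl) f g maps comaps gf fg =
    map f xs ,
    map-unique f unique (λ x∈ y∈ eq → trans (sym (gf (toP x∈))) (trans (cong g eq) (gf (toP y∈)))) ,
    (λ y → mk⇔ (λ y∈ → let x , x∈ , y≡ = ∈-map⁻ f y∈ in subst Q (sym y≡) (maps (toP x∈)))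
               (λ qy → subst (_∈ map f xs) (fg qy) (∈-map⁺ f (Equivalence.from (xs↔P (g y)) (comaps qy))))) ,
    length-map f xs
    where
    toP : ∀ {x} → x ∈ xs → P x
    toP {x} = Equivalence.to (xs↔P x)

HasCard-filter : ∀ {A : Set} {P : A → Set} (P? : Decidable P) {xs : List A} → Unique xs →
  (∀ {x} → P x → x ∈ xs) → HasCard P (length (filter P? xs))
HasCard-filter P? {xs} unique complete =
  filter P? xs , filter⁺ P? unique ,
  (λ x → mk⇔ (proj₂ ∘ ∈-filter⁻ P? {xs = xs}) (λ px → ∈-filter⁺ P? (complete px) px)) , refl

vectorsOver : ∀ {A : Set} → List A → (n : ℕ) → List (Vec A n)
vectorsOver xs zero    = [] ∷ []
vectorsOver xs (suc n) = cartesianProductWith _∷_ xs (vectorsOver xs n)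

module _ {A : Set} (xs : List A) where

  vectorsOver-unique : Unique xs → ∀ n → Unique (vectorsOver xs n)
  vectorsOver-unique unique zero    = All.[] ∷ []
  vectorsOver-unique unique (suc n) =
    cartesianProductWith⁺ _∷_ ∷-injective unique (vectorsOver-unique unique n)
    where
    ∷-injective : ∀ {n} {w x : A} {v u : Vec A n} → w ∷ v ≡ x ∷ u → w ≡ x × v ≡ u
    ∷-injective refl = refl , refl

  ∈-vectorsOver : ∀ {n} (v : Vec A n) → (∀ i → lookup v i ∈ xs) → v ∈ vectorsOver xs n
  ∈-vectorsOver []      _    = here refl
  ∈-vectorsOver (x ∷ v) elem = ∈-cartesianProductWith⁺ _∷_ (elem Fin.zero) (∈-vectorsOver v (elem ∘ Fin.suc))

Kostant : (ℕ → ℕ) → (n : ℕ) → Mat n → Set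
Kostant e n = IsKostant {n} (e ∘ toℕ)

Fits : (ℕ → ℕ) → ℕ → Loops → Set
Fits e n F = ∀ t → t < n → coverage n (strictUpper F) t ≤ e t

Agree : ℕ → Loops → Loops → Set
Agree n F G = ∀ a b → a < b → b < n → F a b ≡ G a b

SupportedBelow : ℕ → Loops → Set
SupportedBelow n F = ∀ a b → n ≤ b → F a b ≡ 0

∀-Fin⇒∀-< : ∀ {n} (P : ℕ → Set) → (∀ (k : Fin n) → P (toℕ k)) → ∀ k → k < n → P k
∀-Fin⇒∀-< P all k k<n = subst P (toℕ-fromℕ< k<n) (all (fromℕ< k<n))

finCoverage : ∀ {n} → Mat n → Fin n → ℕ
finCoverage {n} c t = ΣFin n (λ i → ΣFin n (λ j →
  if ⌊ toℕ i ≤? toℕ t ⌋ then (if ⌊ toℕ t ≤? toℕ j ⌋ then entry c i j else 0) else 0))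

finCoverage≡coverage : ∀ {n} (c : Mat n) (t : Fin n) → finCoverage c t ≡ coverage n (matAt c) (toℕ t)
finCoverage≡coverage {n} c t =
  ΣFin≡∑< n _ (λ i → ΣFin≡∑< n _ (λ j →
    cong (λ x → if ⌊ toℕ i ≤? toℕ t ⌋ then (if ⌊ toℕ t ≤? toℕ j ⌋ then x else 0) else 0) (matAt-entry c i j)))

module _ {n} (c : Mat n) where

  matAt-supported : SupportedBelow n (matAt c)
  matAt-supported a b = matAt-col-outside c a

  matAt-lower : UpperTriangular c → ∀ a b → b < a → matAt c a b ≡ 0
  matAt-lower upper a b b<a with a <? n
  ... | no  a≮n = matAt-row-outside c b (≮⇒≥ a≮n)
  ... | yes a<n = trans (sym entry≡) (upper (fromℕ< a<n) (fromℕ< b<n) j<i)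
    where
    b<n : b < n
    b<n = <-trans b<a a<n
    entry≡ : entry c (fromℕ< a<n) (fromℕ< b<n) ≡ matAt c a b
    entry≡ = trans (matAt-entry c _ _) (cong₂ (matAt c) (toℕ-fromℕ< a<n) (toℕ-fromℕ< b<n))
    j<i : toℕ (fromℕ< b<n) < toℕ (fromℕ< a<n)
    j<i = subst₂ _<_ (sym (toℕ-fromℕ< b<n)) (sym (toℕ-fromℕ< a<n)) b<a

  kostant-coverage : ∀ e → Kostant e n c → ∀ t → t < n → coverage n (matAt c) t ≡ e t
  kostant-coverage e (_ , covers) =
    ∀-Fin⇒∀-< (λ t → coverage n (matAt c) t ≡ e t) (λ t → trans (sym (finCoverage≡coverage c t)) (covers t))

strictUpper-agree : ∀ {n F G} → Agree n F G → ∀ a b → b < n → strictUpper F a b ≡ strictUpper G a b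
strictUpper-agree agree a b b<n with a <? b
... | yes a<b = agree a b a<b b<n
... | no _    = refl

coverage-strictUpper-agree : ∀ {n F G} → Agree n F G → ∀ t →
  coverage n (strictUpper F) t ≡ coverage n (strictUpper G) t
coverage-strictUpper-agree {n} agree t = coverage-cong n t (λ a b _ _ b<n → strictUpper-agree agree a b b<n)

-- A Kostant picture is determined by its loops [a, b] with a < b: the multiplicity of [t, t] is
-- forced to be e t minus the coverage of t by the other loops.
pictureEntry : (ℕ → ℕ) → ℕ → Loops → Loops
pictureEntry e n F a b =
  if ⌊ a <? b ⌋ then F a b else (if ⌊ a ≟ b ⌋ then e a ∸ coverage n (strictUpper F) a else 0)

picture : (ℕ → ℕ) → (n : ℕ) → Loops → Mat n
picture e n F = matFrom n n (pictureEntry e n F)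

module _ (e : ℕ → ℕ) (n : ℕ) (F : Loops) where

  picture-above : ∀ {a b} → a < b → b < n → matAt (picture e n F) a b ≡ F a b
  picture-above {a} {b} a<b b<n = trans (matAt-matFrom n n _ (<-trans a<b b<n) b<n) (if-yes (a <? b) a<b)

  picture-agree : Agree n (matAt (picture e n F)) F
  picture-agree a b = picture-above

  picture-diagonal : ∀ {a} → a < n → matAt (picture e n F) a a ≡ e a ∸ coverage n (strictUpper F) a
  picture-diagonal {a} a<n =
    trans (matAt-matFrom n n _ a<n a<n) (trans (if-no (a <? a) (<-irrefl refl)) (if-yes (a ≟ a) refl))

  picture-kostant : Fits e n F → Kostant e n (picture e n F)
  picture-kostant fits = upper , covers
    where
    upper : UpperTriangular (picture e n F)
    upper = matFrom-upperTriangular n _ (λ i j j<i →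
              trans (if-no (i <? j) (<⇒≯ j<i)) (if-no (i ≟ j) (≢-sym (<⇒≢ j<i))))
    P : Mat n
    P = picture e n F
    covers : ∀ t → finCoverage P t ≡ e (toℕ t)
    covers t = begin
      finCoverage P t                                           ≡⟨ finCoverage≡coverage P t ⟩
      coverage n (matAt P) (toℕ t)                              ≡⟨ coverage-diagonal n _ (toℕ<n t) ⟩
      matAt P (toℕ t) (toℕ t) + coverage n (strictUpper (matAt P)) (toℕ t)
                                                                ≡⟨ cong₂ _+_ (picture-diagonal (toℕ<n t))
                                                                     (coverage-strictUpper-agree picture-agree _) ⟩
      e (toℕ t) ∸ coverage n (strictUpper F) (toℕ t) + coverage n (strictUpper F) (toℕ t)
                                                                ≡⟨ m∸n+n≡m (fits (toℕ t) (toℕ<n t)) ⟩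
      e (toℕ t)                                                 ∎
      where open ≡-Reasoning

picture-cong : ∀ e n {F G} → Agree n F G → picture e n F ≡ picture e n G
picture-cong e n {F} {G} agree =
  matAt-injective _ _ (λ a b a<n b<n →
    trans (matAt-matFrom n n _ a<n b<n) (trans (entry-agree a b b<n) (sym (matAt-matFrom n n _ a<n b<n))))
  where
  entry-agree : ∀ a b → b < n → pictureEntry e n F a b ≡ pictureEntry e n G a b
  entry-agree a b b<n with a <? b
  ... | yes a<b = agree a b a<b b<n
  ... | no _ with a ≟ b
  ...   | yes _ = cong (e a ∸_) (coverage-strictUpper-agree agree a)
  ...   | no _  = refl

picture-injective : ∀ e n {F G} → picture e n F ≡ picture e n G → Agree n F G
picture-injective e n {F} {G} eq a b a<b b<n =
  trans (sym (picture-above e n F a<b b<n)) (trans (cong (λ c → matAt c a b) eq) (picture-above e n G a<b b<n))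

module _ (e : ℕ → ℕ) {n : ℕ} (c : Mat n) (kostant : Kostant e n c) where

  private
    diagonal+strictUpper : ∀ {t} → t < n → matAt c t t + coverage n (strictUpper (matAt c)) t ≡ e t
    diagonal+strictUpper t<n =
      trans (sym (coverage-diagonal n (matAt c) t<n)) (kostant-coverage c e kostant _ t<n)

  kostant-fits : Fits e n (matAt c)
  kostant-fits t t<n = subst (coverage n (strictUpper (matAt c)) t ≤_) (diagonal+strictUpper t<n) (m≤n+m _ _)

  kostant-picture : c ≡ picture e n (matAt c)
  kostant-picture =
    matAt-injective _ _ (λ a b a<n b<n → sym (trans (matAt-matFrom n n _ a<n b<n) (entry-≡ a b a<n)))
    where
    entry-≡ : ∀ a b → a < n → pictureEntry e n (matAt c) a b ≡ matAt c a b
    entry-≡ a b a<n with a <? b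
    ... | yes _ = refl
    ... | no a≮b with a ≟ b
    ...   | yes refl = let cov = coverage n (strictUpper (matAt c)) a in
                       trans (cong (_∸ cov) (sym (diagonal+strictUpper a<n))) (m+n∸n≡m (matAt c a a) cov)
    ...   | no a≢b   = sym (matAt-lower c (proj₁ kostant) a b (≤∧≢⇒< (≮⇒≥ a≮b) (≢-sym a≢b)))

kostant? : ∀ e n → Decidable (Kostant e n)
kostant? e n c = upper? ×-dec all? (λ t → finCoverage c t ≟ e (toℕ t))
  where
  upper? : Dec (UpperTriangular c)
  upper? = all? (λ i → all? (λ j → (toℕ j <? toℕ i) →-dec (entry c i j ≟ 0)))

kostant-entry-≤ : ∀ e {n} (c : Mat n) → Kostant e n c → ∀ i j → entry c i j ≤ ∑< n e
kostant-entry-≤ e {n} c kostant i j with toℕ j <? toℕ i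
... | yes j<i = subst (_≤ ∑< n e) (sym (proj₁ kostant i j j<i)) z≤n
... | no  j≮i = begin
  entry c i j                                     ≡⟨ matAt-entry c i j ⟩
  matAt c (toℕ i) (toℕ j)                         ≡⟨ through-inside (matAt c) ≤-refl (≮⇒≥ j≮i) ⟨
  through (toℕ i) (matAt c) (toℕ i) (toℕ j)       ≤⟨ ∑<-term n _ (toℕ<n j) ⟩
  ∑[ b < n ] through (toℕ i) (matAt c) (toℕ i) b  ≤⟨ ∑<-term n (λ a → ∑[ b < n ] through (toℕ i) (matAt c) a b)
                                                             (toℕ<n i) ⟩
  coverage n (matAt c) (toℕ i)                    ≡⟨ kostant-coverage c e kostant (toℕ i) (toℕ<n i) ⟩
  e (toℕ i)                                       ≤⟨ ∑<-term n e (toℕ<n i) ⟩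
  ∑< n e                                          ∎
  where open ≤-Reasoning

kostantCard : ∀ e n → Σ ℕ (HasCard (Kostant e n))
kostantCard e n =
  _ , HasCard-filter (kostant? e n) (vectorsOver-unique rows (vectorsOver-unique entries (upTo⁺ _) n) n)
                     complete
  where
  entries : List ℕ
  entries = upTo (suc (∑< n e))
  rows : List (Vec ℕ n)
  rows = vectorsOver entries n
  complete : ∀ {c} → Kostant e n c → c ∈ vectorsOver rows n
  complete {c} kostant = ∈-vectorsOver rows c (λ i → ∈-vectorsOver entries (lookup c i) (λ j →
                           ∈-upTo⁺ (s≤s (kostant-entry-≤ e c kostant i j))))

-- Opaque: #K is only used through #K-card, and unfolding the enumeration behind it is expensive.
opaque
  #K : (ℕ → ℕ) → ℕ → ℕ
  #K e n = proj₁ (kostantCard e n)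

  #K-card : ∀ e n → HasCard (Kostant e n) (#K e n)
  #K-card e n = proj₂ (kostantCard e n)

#K-≤ : ∀ {e n} {B : Set} {Q : B → Set} {l} → HasCard Q l → (encode : Loops → B) →
  (∀ F → SupportedBelow n F → Fits e n F → Q (encode F)) →
  (∀ F G → encode F ≡ encode G → Agree n F G) → #K e n ≤ l
#K-≤ {e} {n} card encode maps-to injective =
  HasCard-≤ (#K-card e n) card (encode ∘ matAt)
    (λ {c} kostant → maps-to (matAt c) (matAt-supported c) (kostant-fits e c kostant))
    (λ {c} {d} kc kd eq → trans (kostant-picture e c kc) (trans (picture-cong e n (injective _ _ eq))
                                                                (sym (kostant-picture e d kd))))

#K-≤-#K : ∀ {e n e′ n′} (T : Loops → Loops) →
  (∀ F → SupportedBelow n F → Fits e n F → Fits e′ n′ (T F)) →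
  (∀ F G → Agree n′ (T F) (T G) → Agree n F G) → #K e n ≤ #K e′ n′
#K-≤-#K {e′ = e′} {n′} T fits reflects =
  #K-≤ (#K-card e′ n′) (picture e′ n′ ∘ T)
    (λ F supported fitsF → picture-kostant e′ n′ (T F) (fits F supported fitsF))
    (λ F G eq → reflects F G (picture-injective e′ n′ eq))

unshift : ℕ → Loops → Loops
unshift o F a b = if ⌊ o ≤? a ⌋ then F (a ∸ o) (b ∸ o) else 0

unshift-shift : ∀ o F a b → unshift o F (o + a) (o + b) ≡ F a b
unshift-shift o F a b = trans (if-yes (o ≤? o + a) (m≤m+n o a)) (cong₂ F (m+n∸m≡n o a) (m+n∸m≡n o b))

unshift-low : ∀ o F a b → a < o → unshift o F a b ≡ 0
unshift-low o F a b a<o = if-no (o ≤? a) (<⇒≱ a<o)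

#K-offset : ∀ {e e′} o W → (∀ t → t < W → e t ≤ e′ (o + t)) → #K e W ≤ #K e′ (o + W)
#K-offset {e} {e′} o W e≤e′ = #K-≤-#K (unshift o) fits reflects
  where
  strictUpper-low : ∀ F a b → a < o → strictUpper (unshift o F) a b ≡ 0
  strictUpper-low F a b a<o = strictUpper-≡0 (unshift o F) a b (unshift-low o F a b a<o)
  shift-strictUpper-unshift : ∀ F a b → shift o (strictUpper (unshift o F)) a b ≡ strictUpper F a b
  shift-strictUpper-unshift F a b with a <? b
  ... | yes a<b = trans (strictUpper-above (unshift o F) (+-monoʳ-< o a<b)) (unshift-shift o F a b)
  ... | no a≮b  = strictUpper-below (unshift o F) (+-monoʳ-≤ o (≮⇒≥ a≮b))
  fits-shifted : ∀ F → Fits e W F → ∀ t → t < W →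
                 coverage (o + W) (strictUpper (unshift o F)) (o + t) ≤ e′ (o + t)
  fits-shifted F fitsF t t<W = begin
    coverage (o + W) (strictUpper (unshift o F)) (o + t)  ≡⟨ coverage-shift o W _ t (strictUpper-low F) ⟩
    coverage W (shift o (strictUpper (unshift o F))) t    ≡⟨ coverage-cong W t (λ a b _ _ _ →
                                                               shift-strictUpper-unshift F a b) ⟩
    coverage W (strictUpper F) t                          ≤⟨ fitsF t t<W ⟩
    e t                                                   ≤⟨ e≤e′ t t<W ⟩
    e′ (o + t)                                            ∎
    where open ≤-Reasoning
  fits : ∀ F → SupportedBelow W F → Fits e W F → Fits e′ (o + W) (unshift o F)
  fits F _ fitsF t t<o+W with o ≤? t
  ... | no  o≰t = subst (_≤ e′ t) (sym (coverage-zero (o + W) _ t (λ a b a≤t _ _ →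
                    strictUpper-low F a b (≤-<-trans a≤t (≰⇒> o≰t))))) z≤n
  ... | yes o≤t = subst (λ s → coverage (o + W) (strictUpper (unshift o F)) s ≤ e′ s) (m+[n∸m]≡n o≤t)
                        (fits-shifted F fitsF (t ∸ o) (subst (t ∸ o <_) (m+n∸m≡n o W) (∸-monoˡ-< t<o+W o≤t)))
  reflects : ∀ F G → Agree (o + W) (unshift o F) (unshift o G) → Agree W F G
  reflects F G agree a b a<b b<W =
    trans (sym (unshift-shift o F a b))
          (trans (agree (o + a) (o + b) (+-monoʳ-< o a<b) (+-monoʳ-< o b<W)) (unshift-shift o G a b))

#K-mono : ∀ {e e′} n → (∀ t → t < n → e t ≤ e′ t) → #K e n ≤ #K e′ n
#K-mono = #K-offset 0

takeUpTo : ℕ → (ℕ → ℕ) → ℕ → ℕ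
takeUpTo x v zero    = v 0 ⊓ x
takeUpTo x v (suc j) = takeUpTo (x ∸ v 0 ⊓ x) (v ∘ suc) j

takeUpTo-≤ : ∀ x v j → takeUpTo x v j ≤ v j
takeUpTo-≤ x v zero    = m⊓n≤m (v 0) x
takeUpTo-≤ x v (suc j) = takeUpTo-≤ (x ∸ v 0 ⊓ x) (v ∘ suc) j

∑<-takeUpTo : ∀ n x v → ∑< n (takeUpTo x v) ≡ ∑< n v ⊓ x
∑<-takeUpTo zero    x v = refl
∑<-takeUpTo (suc n) x v = begin
  v 0 ⊓ x + ∑< n (takeUpTo (x ∸ v 0 ⊓ x) (v ∘ suc))  ≡⟨ cong (v 0 ⊓ x +_) (∑<-takeUpTo n _ (v ∘ suc)) ⟩
  v 0 ⊓ x + S ⊓ (x ∸ v 0 ⊓ x)                        ≡⟨ +-distribˡ-⊓ (v 0 ⊓ x) S _ ⟩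
  (v 0 ⊓ x + S) ⊓ (v 0 ⊓ x + (x ∸ v 0 ⊓ x))          ≡⟨ cong ((v 0 ⊓ x + S) ⊓_) (m+[n∸m]≡n (m⊓n≤n (v 0) x)) ⟩
  (v 0 ⊓ x + S) ⊓ x                                  ≡⟨ head-absorbed ⟩
  (v 0 + S) ⊓ x                                      ∎
  where
  open ≡-Reasoning
  S : ℕ
  S = ∑< n (v ∘ suc)
  head-absorbed : (v 0 ⊓ x + S) ⊓ x ≡ (v 0 + S) ⊓ x
  head-absorbed with ≤-total (v 0) x
  ... | inj₁ v₀≤x = cong (λ m → (m + S) ⊓ x) (m≤n⇒m⊓n≡m v₀≤x)
  ... | inj₂ x≤v₀ = begin
    (v 0 ⊓ x + S) ⊓ x  ≡⟨ cong (λ m → (m + S) ⊓ x) (m≥n⇒m⊓n≡n x≤v₀) ⟩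
    (x + S) ⊓ x        ≡⟨ m≥n⇒m⊓n≡n (m≤m+n x S) ⟩
    x                  ≡⟨ m≥n⇒m⊓n≡n (≤-trans x≤v₀ (m≤m+n (v 0) S)) ⟨
    (v 0 + S) ⊓ x      ∎

-- lower takes from row t (the loops [t, b] with t < b) a greedy part of total
-- min (rowSum t, h₁ - loops of lower entering t), and upper keeps the rest. The quota of row t
-- depends on the earlier rows of lower, so lower is built row by row: layers t holds the rows < t.
module GreedySplit (n h₁ : ℕ) (F : Loops) where

  quota : Loops → ℕ → ℕ
  quota P t = rowSum n F t ⊓ (h₁ ∸ entering n P t)

  layers : ℕ → Loops
  layers zero    a b = 0
  layers (suc t) a b = if ⌊ a ≟ t ⌋ then takeUpTo (quota (layers t) t) (strictUpper F t) b else layers t a b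

  lower : Loops
  lower a b = layers (suc a) a b

  upper : Loops
  upper a b = F a b ∸ lower a b

  layers-stable : ∀ {t a} b → a < t → layers t a b ≡ lower a b
  layers-stable {suc t} {a} b a<1+t with a ≟ t
  ... | yes refl = sym (if-yes (a ≟ a) refl)
  ... | no  a≢t  = layers-stable b (≤∧≢⇒< (≤-pred a<1+t) a≢t)

  lower-row : ∀ t b → lower t b ≡ takeUpTo (quota lower t) (strictUpper F t) b
  lower-row t b =
    trans (if-yes (t ≟ t) refl)
          (cong (λ e → takeUpTo (rowSum n F t ⊓ (h₁ ∸ e)) (strictUpper F t) b) entering-layers)
    where
    entering-layers : entering n (layers t) t ≡ entering n lower t
    entering-layers = ∑<-cong t (λ i i<t → ∑<-cong n (λ j _ →
                        cong (λ x → if ⌊ t ≤? j ⌋ then x else 0) (layers-stable j i<t)))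

  lower-≤ : ∀ a b → lower a b ≤ strictUpper F a b
  lower-≤ a b = subst (_≤ strictUpper F a b) (sym (lower-row a b)) (takeUpTo-≤ _ _ b)

  strictUpper-lower : ∀ a b → strictUpper lower a b ≡ lower a b
  strictUpper-lower a b with <-≤-connex a b
  ... | inj₁ a<b = strictUpper-above lower a<b
  ... | inj₂ b≤a = trans (strictUpper-below lower b≤a)
                         (sym (n≤0⇒n≡0 (subst (lower a b ≤_) (strictUpper-below F b≤a) (lower-≤ a b))))

  rowSum-lower : ∀ t → rowSum n lower t ≡ quota lower t
  rowSum-lower t = begin
    ∑[ j < n ] strictUpper lower t j                   ≡⟨ ∑<-cong n (λ j _ → trans (strictUpper-lower t j)
                                                                                  (lower-row t j)) ⟩
    ∑< n (takeUpTo (quota lower t) (strictUpper F t))  ≡⟨ ∑<-takeUpTo n _ _ ⟩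
    rowSum n F t ⊓ quota lower t                       ≡⟨ m≥n⇒m⊓n≡n (m⊓n≤m _ _) ⟩
    quota lower t                                      ∎
    where open ≡-Reasoning

  upper+lower : ∀ a b → upper a b + lower a b ≡ F a b
  upper+lower a b = m∸n+n≡m (≤-trans (lower-≤ a b) (strictUpper-≤ F a b))

  strictUpper-split : ∀ a b → strictUpper F a b ≡ strictUpper upper a b + strictUpper lower a b
  strictUpper-split a b with <-≤-connex a b
  ... | inj₁ a<b = trans (strictUpper-above F a<b) (trans (sym (upper+lower a b))
                         (sym (cong₂ _+_ (strictUpper-above upper a<b) (strictUpper-above lower a<b))))
  ... | inj₂ b≤a = trans (strictUpper-below F b≤a)
                         (sym (cong₂ _+_ (strictUpper-below upper b≤a) (strictUpper-below lower b≤a)))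

  coverage-split : ∀ t → coverage n (strictUpper F) t ≡
                         coverage n (strictUpper upper) t + coverage n (strictUpper lower) t
  coverage-split t = trans (coverage-cong n t (λ a b _ _ _ → strictUpper-split a b)) (coverage-+ n _ _ t)

  rowSum-split : ∀ t → rowSum n F t ≡ rowSum n upper t + rowSum n lower t
  rowSum-split t = trans (∑<-cong n (λ j _ → strictUpper-split t j)) (∑<-distrib-+ n _ _)

  lower-coverage : ∀ {t} → t < n → coverage n (strictUpper lower) t ≡ entering n lower t + quota lower t
  lower-coverage {t} t<n =
    trans (coverage-entering+rowSum n lower t<n) (cong (entering n lower t +_) (rowSum-lower t))

  lower-fits : ∀ {t} → t < n → entering n lower t ≤ h₁ → coverage n (strictUpper lower) t ≤ h₁
  lower-fits {t} t<n entering≤h₁ = begin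
    coverage n (strictUpper lower) t                ≡⟨ lower-coverage t<n ⟩
    entering n lower t + quota lower t              ≤⟨ +-monoʳ-≤ (entering n lower t) (m⊓n≤n _ _) ⟩
    entering n lower t + (h₁ ∸ entering n lower t)  ≡⟨ m+[n∸m]≡n entering≤h₁ ⟩
    h₁                                              ∎
    where open ≤-Reasoning

  lower-full : ∀ {t} → t < n → entering n lower t ≤ h₁ → h₁ ∸ entering n lower t ≤ rowSum n F t →
               coverage n (strictUpper lower) t ≡ h₁
  lower-full {t} t<n entering≤h₁ overflow = begin
    coverage n (strictUpper lower) t                ≡⟨ lower-coverage t<n ⟩
    entering n lower t + quota lower t              ≡⟨ cong (entering n lower t +_) (m≥n⇒m⊓n≡n overflow) ⟩
    entering n lower t + (h₁ ∸ entering n lower t)  ≡⟨ m+[n∸m]≡n entering≤h₁ ⟩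
    h₁                                              ∎
    where open ≡-Reasoning

  upper-row-empty : ∀ t → rowSum n F t ≤ h₁ ∸ entering n lower t → rowSum n upper t ≡ 0
  upper-row-empty t row-fits = +-cancelʳ-≡ (rowSum n lower t) (rowSum n upper t) 0 (begin
    rowSum n upper t + rowSum n lower t  ≡⟨ rowSum-split t ⟨
    rowSum n F t                         ≡⟨ m≤n⇒m⊓n≡m row-fits ⟨
    quota lower t                        ≡⟨ rowSum-lower t ⟨
    rowSum n lower t                     ∎)
    where open ≡-Reasoning

  module _ (h₂ : ℕ) (fits : Fits (λ _ → h₁ + h₂) n F) where

    bounds : ∀ t → t < n → coverage n (strictUpper lower) t ≤ h₁ × coverage n (strictUpper upper) t ≤ h₂

    entering-bounds : ∀ t → t < n → entering n lower t ≤ h₁ × entering n upper t ≤ h₂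
    entering-bounds zero    _     = z≤n , z≤n
    entering-bounds (suc t) t+1<n =
      let t<n = <-trans (n<1+n t) t+1<n
          lower-bound , upper-bound = bounds t t<n
      in ≤-trans (entering-suc-≤ n lower t<n) lower-bound , ≤-trans (entering-suc-≤ n upper t<n) upper-bound

    bounds t t<n = lower-fits t<n lower-entering , upper-fits (rowSum n F t ≤? h₁ ∸ entering n lower t)
      where
      lower-entering : entering n lower t ≤ h₁
      lower-entering = proj₁ (entering-bounds t t<n)
      upper-entering : entering n upper t ≤ h₂
      upper-entering = proj₂ (entering-bounds t t<n)
      upper-fits : Dec (rowSum n F t ≤ h₁ ∸ entering n lower t) → coverage n (strictUpper upper) t ≤ h₂
      upper-fits (yes row-fits) = begin
        coverage n (strictUpper upper) t       ≡⟨ coverage-entering+rowSum n upper t<n ⟩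
        entering n upper t + rowSum n upper t  ≡⟨ cong (entering n upper t +_) (upper-row-empty t row-fits) ⟩
        entering n upper t + 0                 ≡⟨ +-identityʳ _ ⟩
        entering n upper t                     ≤⟨ upper-entering ⟩
        h₂                                     ∎
        where open ≤-Reasoning
      upper-fits (no row-overflows) = +-cancelʳ-≤ h₁ _ _ (begin
        coverage n (strictUpper upper) t + h₁  ≡⟨ cong (coverage n (strictUpper upper) t +_)
                                                       (lower-full t<n lower-entering (<⇒≤ (≰⇒> row-overflows))) ⟨
        coverage n (strictUpper upper) t + coverage n (strictUpper lower) t
                                               ≡⟨ coverage-split t ⟨
        coverage n (strictUpper F) t           ≤⟨ fits t t<n ⟩
        h₁ + h₂                                ≡⟨ +-comm h₁ h₂ ⟩
        h₂ + h₁                                ∎)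
        where open ≤-Reasoning

#K-height-split : ∀ n h₁ h₂ → #K (λ _ → h₁ + h₂) n ≤ #K (λ _ → h₁) n * #K (λ _ → h₂) n
#K-height-split n h₁ h₂ = #K-≤ (HasCard-× (#K-card _ n) (#K-card _ n)) encode maps-to reflects
  where
  open GreedySplit n h₁
  encode : Loops → Mat n × Mat n
  encode F = picture (λ _ → h₁) n (lower F) , picture (λ _ → h₂) n (upper F)
  maps-to : ∀ F → SupportedBelow n F → Fits (λ _ → h₁ + h₂) n F →
            (Kostant (λ _ → h₁) n ⟨×⟩ Kostant (λ _ → h₂) n) (encode F)
  maps-to F _ fits = picture-kostant _ n (lower F) (λ t t<n → proj₁ (bounds F h₂ fits t t<n))
                   , picture-kostant _ n (upper F) (λ t t<n → proj₂ (bounds F h₂ fits t t<n))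
  reflects : ∀ F G → encode F ≡ encode G → Agree n F G
  reflects F G eq a b a<b b<n = begin
    F a b                      ≡⟨ upper+lower F a b ⟨
    upper F a b + lower F a b  ≡⟨ cong₂ _+_ (picture-injective _ n (cong proj₂ eq) a b a<b b<n)
                                           (picture-injective _ n (cong proj₁ eq) a b a<b b<n) ⟩
    upper G a b + lower G a b  ≡⟨ upper+lower G a b ⟩
    G a b                      ∎
    where open ≡-Reasoning

#K-height-multiple : ∀ c h n → #K (λ _ → suc c * h) n ≤ #K (λ _ → h) n ^ suc c
#K-height-multiple zero    h n =
  ≤-trans (#K-mono n (λ _ _ → ≤-reflexive (+-identityʳ h))) (≤-reflexive (sym (*-identityʳ _)))
#K-height-multiple (suc c) h n =
  ≤-trans (#K-height-split n h (suc c * h)) (*-monoʳ-≤ (#K (λ _ → h) n) (#K-height-multiple c h n))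

-- A loop [a, w₁ + j] crossing the middle (a < w₁) is stored as the loop [a, j + 1] of crossingLow
-- when a ≤ j, and as the loop [j, a] of crossingHigh when j < a.
module _ (w₁ : ℕ) where

  leftBlock : Loops → Loops
  leftBlock F a b = if ⌊ b <? w₁ ⌋ then F a b else 0

  crossingLow : Loops → Loops
  crossingLow F a b = if ⌊ a <? w₁ ⌋ then F a (w₁ + pred b) else 0

  crossingHigh : Loops → Loops
  crossingHigh F a b = if ⌊ b <? w₁ ⌋ then F b (w₁ + a) else 0

module WidthSplit {w₁ w₂ W : ℕ} (h : ℕ) (w₁<W : w₁ < W) (w₂<W : w₂ < W) (W≤n : W ≤ w₁ + w₂) where

  n : ℕ
  n = w₁ + w₂

  crossings : Loops → ℕ
  crossings F = ∑[ a < w₁ ] ∑[ j < w₂ ] F a (w₁ + j)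

  crossings-≤-coverage : ∀ F → crossings F ≤ coverage n (strictUpper F) w₁
  crossings-≤-coverage F = begin
    ∑[ a < w₁ ] ∑[ j < w₂ ] F a (w₁ + j)                    ≡⟨ ∑<-cong w₁ (λ a a<w₁ → ∑<-cong w₂ (λ j _ →
                                                                 crossing-through a<w₁ j)) ⟨
    ∑[ a < w₁ ] ∑[ j < w₂ ] X a (w₁ + j)                    ≤⟨ ∑<-mono w₁ (λ a _ → m≤n+m _ _) ⟩
    ∑[ a < w₁ ] (∑< w₁ (X a) + ∑[ j < w₂ ] X a (w₁ + j))    ≡⟨ ∑<-cong w₁ (λ a _ → ∑<-split w₁ w₂ (X a)) ⟨
    ∑[ a < w₁ ] ∑< n (X a)                                  ≤⟨ m≤m+n _ _ ⟩
    ∑[ a < w₁ ] ∑< n (X a) + ∑[ i < w₂ ] ∑< n (X (w₁ + i))  ≡⟨ ∑<-split w₁ w₂ _ ⟨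
    coverage n (strictUpper F) w₁                           ∎
    where
    open ≤-Reasoning
    X : Loops
    X = through w₁ (strictUpper F)
    crossing-through : ∀ {a} → a < w₁ → ∀ j → X a (w₁ + j) ≡ F a (w₁ + j)
    crossing-through a<w₁ j = trans (through-inside (strictUpper F) (<⇒≤ a<w₁) (m≤m+n w₁ j))
                                    (strictUpper-above F (<-≤-trans a<w₁ (m≤m+n w₁ j)))

  0<w₂ : 0 < w₂
  0<w₂ = +-cancelˡ-< w₁ 0 w₂ (subst (_< w₁ + w₂) (sym (+-identityʳ w₁)) (<-≤-trans w₁<W W≤n))

  crossings-≤ : ∀ F → Fits (λ _ → h) n F → crossings F ≤ h
  crossings-≤ F fits = ≤-trans (crossings-≤-coverage F) (fits w₁ (m<m+n w₁ 0<w₂))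

  crossing-row : ∀ F → SupportedBelow n F → ∀ {m} a → w₂ ≤ m →
                 ∑[ j < m ] F a (w₁ + j) ≡ ∑[ j < w₂ ] F a (w₁ + j)
  crossing-row F supported a w₂≤m =
    ∑<-vanishing-tail _ w₂≤m (λ j w₂≤j _ → supported a (w₁ + j) (+-monoʳ-≤ w₁ w₂≤j))

  fits-by-total : ∀ G → ∑[ a < W ] ∑[ b < W ] strictUpper G a b ≤ h → Fits (λ _ → h) W G
  fits-by-total G total≤h t _ = ≤-trans (coverage-≤-total W (strictUpper G) t) total≤h

  module _ (F : Loops) (supported : SupportedBelow n F) (fits : Fits (λ _ → h) n F) where

    leftBlock-fits : Fits (λ _ → h) W (leftBlock w₁ F)
    leftBlock-fits t t<W = begin
      coverage W X t                ≡⟨ coverage-narrow X t (<⇒≤ w₁<W) right-of-w₁ ⟩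
      coverage w₁ X t               ≡⟨ coverage-narrow X t (m≤m+n w₁ w₂) right-of-w₁ ⟨
      coverage n X t                ≤⟨ coverage-mono n t (λ a b _ _ _ →
                                         strictUpper-mono {leftBlock w₁ F} {F} a b (if-≤ ⌊ b <? w₁ ⌋ (F a b))) ⟩
      coverage n (strictUpper F) t  ≤⟨ fits t (<-≤-trans t<W W≤n) ⟩
      h                             ∎
      where
      open ≤-Reasoning
      X : Loops
      X = strictUpper (leftBlock w₁ F)
      right-of-w₁ : ∀ a b → w₁ ≤ b → X a b ≡ 0
      right-of-w₁ a b w₁≤b = strictUpper-≡0 (leftBlock w₁ F) a b (if-no (b <? w₁) (≤⇒≯ w₁≤b))

    rightBlock-fits : Fits (λ _ → h) W (shift w₁ F)
    rightBlock-fits t t<W = subst (_≤ h) (sym narrowed) (bounded (t <? w₂))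
      where
      X : Loops
      X = shift w₁ (strictUpper F)
      beyond-w₂ : ∀ a b → w₂ ≤ b → X a b ≡ 0
      beyond-w₂ a b w₂≤b =
        strictUpper-≡0 F (w₁ + a) (w₁ + b) (supported (w₁ + a) (w₁ + b) (+-monoʳ-≤ w₁ w₂≤b))
      narrowed : coverage W (strictUpper (shift w₁ F)) t ≡ coverage w₂ X t
      narrowed = trans (coverage-cong W t (λ a b _ _ _ → strictUpper-shift w₁ F a b))
                       (coverage-narrow X t (<⇒≤ w₂<W) beyond-w₂)
      bounded : Dec (t < w₂) → coverage w₂ X t ≤ h
      bounded (yes t<w₂) =
        ≤-trans (coverage-shift-≤ w₁ w₂ (strictUpper F) t) (fits (w₁ + t) (+-monoʳ-< w₁ t<w₂))
      bounded (no  t≮w₂) =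
        subst (_≤ h) (sym (coverage-zero w₂ X t (λ a b _ t≤b b<w₂ → ⊥-elim (t≮w₂ (≤-<-trans t≤b b<w₂))))) z≤n

    crossingLow-fits : Fits (λ _ → h) W (crossingLow w₁ F)
    crossingLow-fits = fits-by-total (crossingLow w₁ F) (begin
      ∑[ a < W ] ∑< W (Y a)   ≡⟨ ∑<-vanishing-tail _ (<⇒≤ w₁<W) (λ a w₁≤a _ → ∑<-zero W (λ b _ →
                                   left-of-w₁ a b w₁≤a)) ⟩
      ∑[ a < w₁ ] ∑< W (Y a)  ≤⟨ ∑<-mono w₁ (λ a a<w₁ → row a a<w₁) ⟩
      crossings F             ≤⟨ crossings-≤ F fits ⟩
      h                       ∎)
      where
      open ≤-Reasoning
      Y : Loops
      Y = strictUpper (crossingLow w₁ F)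
      left-of-w₁ : ∀ a b → w₁ ≤ a → Y a b ≡ 0
      left-of-w₁ a b w₁≤a = strictUpper-≡0 (crossingLow w₁ F) a b (if-no (a <? w₁) (≤⇒≯ w₁≤a))
      beyond-w₂ : ∀ a b → suc w₂ ≤ b → Y a b ≡ 0
      beyond-w₂ a (suc b) (s≤s w₂≤b) = strictUpper-≡0 (crossingLow w₁ F) a (suc b)
        (if-≡0 ⌊ a <? w₁ ⌋ (supported a (w₁ + b) (+-monoʳ-≤ w₁ w₂≤b)))
      row : ∀ a → a < w₁ → ∑< W (Y a) ≤ ∑[ j < w₂ ] F a (w₁ + j)
      row a a<w₁ = begin
        ∑< W (Y a)                       ≡⟨ ∑<-vanishing-tail (Y a) w₂<W (λ b w₂<b _ → beyond-w₂ a b w₂<b) ⟩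
        Y a 0 + ∑[ j < w₂ ] Y a (suc j)  ≡⟨ cong (_+ ∑[ j < w₂ ] Y a (suc j))
                                                 (strictUpper-below (crossingLow w₁ F) {a} {0} z≤n) ⟩
        ∑[ j < w₂ ] Y a (suc j)          ≤⟨ ∑<-mono w₂ (λ j _ →
                                              ≤-trans (strictUpper-≤ (crossingLow w₁ F) a (suc j))
                                                      (≤-reflexive (if-yes (a <? w₁) a<w₁))) ⟩
        ∑[ j < w₂ ] F a (w₁ + j)         ∎

    crossingHigh-fits : Fits (λ _ → h) W (crossingHigh w₁ F)
    crossingHigh-fits = fits-by-total Z (begin
      ∑[ a < W ] ∑[ b < W ] strictUpper Z a b  ≤⟨ ∑<-mono W (λ a _ → ∑<-mono W (λ b _ → strictUpper-≤ Z a b)) ⟩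
      ∑[ a < W ] ∑[ b < W ] Z a b              ≡⟨ ∑<-swap W W Z ⟩
      ∑[ b < W ] ∑[ a < W ] Z a b              ≡⟨ ∑<-vanishing-tail _ (<⇒≤ w₁<W) (λ b w₁≤b _ → ∑<-zero W (λ a _ →
                                                    if-no (b <? w₁) (≤⇒≯ w₁≤b))) ⟩
      ∑[ b < w₁ ] ∑[ a < W ] Z a b             ≡⟨ ∑<-cong w₁ (λ b b<w₁ → ∑<-cong W (λ a _ →
                                                    if-yes (b <? w₁) b<w₁)) ⟩
      ∑[ b < w₁ ] ∑[ a < W ] F b (w₁ + a)      ≡⟨ ∑<-cong w₁ (λ b _ → crossing-row F supported b (<⇒≤ w₂<W)) ⟩
      crossings F                              ≤⟨ crossings-≤ F fits ⟩
      h                                        ∎)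
      where
      open ≤-Reasoning
      Z : Loops
      Z = crossingHigh w₁ F

  reflects : ∀ F G → Agree W (leftBlock w₁ F) (leftBlock w₁ G) → Agree W (shift w₁ F) (shift w₁ G) →
             Agree W (crossingLow w₁ F) (crossingLow w₁ G) → Agree W (crossingHigh w₁ F) (crossingHigh w₁ G) →
             Agree n F G
  reflects F G left right low high a b a<b b<n with <-≤-connex b w₁
  ... | inj₁ b<w₁ = trans (sym (if-yes (b <? w₁) b<w₁))
                          (trans (left a b a<b (<-trans b<w₁ w₁<W)) (if-yes (b <? w₁) b<w₁))
  ... | inj₂ w₁≤b = subst (λ b → F a b ≡ G a b) (m+[n∸m]≡n w₁≤b) (second-block (b ∸ w₁)
                      (+-cancelˡ-< w₁ _ _ (subst (_< n) (sym (m+[n∸m]≡n w₁≤b)) b<n))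
                      (subst (a <_) (sym (m+[n∸m]≡n w₁≤b)) a<b))
    where
    second-block : ∀ j → j < w₂ → a < w₁ + j → F a (w₁ + j) ≡ G a (w₁ + j)
    second-block j j<w₂ a<w₁+j with <-≤-connex a w₁
    ... | inj₂ w₁≤a = subst (λ a → F a (w₁ + j) ≡ G a (w₁ + j)) (m+[n∸m]≡n w₁≤a) (right (a ∸ w₁) j
                        (+-cancelˡ-< w₁ _ _ (subst (_< w₁ + j) (sym (m+[n∸m]≡n w₁≤a)) a<w₁+j))
                        (<-trans j<w₂ w₂<W))
    ... | inj₁ a<w₁ with ≤-<-connex a j
    ...   | inj₁ a≤j = trans (sym (if-yes (a <? w₁) a<w₁))
                       (trans (low a (suc j) (s≤s a≤j) (<-≤-trans (s≤s j<w₂) w₂<W)) (if-yes (a <? w₁) a<w₁))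
    ...   | inj₂ j<a = trans (sym (if-yes (a <? w₁) a<w₁))
                       (trans (high j a j<a (<-trans a<w₁ w₁<W)) (if-yes (a <? w₁) a<w₁))

#K-width-split : ∀ {w₁ w₂ W} h → w₁ < W → w₂ < W → W ≤ w₁ + w₂ →
                 #K (λ _ → h) (w₁ + w₂) ≤ #K (λ _ → h) W ^ 4
#K-width-split {w₁} {w₂} {W} h w₁<W w₂<W W≤n = begin
  #K H (w₁ + w₂)     ≤⟨ #K-≤ (HasCard-× (HasCard-× card card) (HasCard-× card card)) encode maps-to injective ⟩
  (k * k) * (k * k)  ≡⟨ *-assoc k k (k * k) ⟩
  k * (k * (k * k))  ≡⟨ cong (λ m → k * (k * (k * m))) (*-identityʳ k) ⟨
  k ^ 4              ∎
  where
  open ≤-Reasoning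
  open WidthSplit h w₁<W w₂<W W≤n
  H : ℕ → ℕ
  H _ = h
  k : ℕ
  k = #K H W
  K : Mat W → Set
  K = Kostant H W
  card : HasCard K k
  card = #K-card H W
  pic : Loops → Mat W
  pic = picture H W
  encode : Loops → (Mat W × Mat W) × (Mat W × Mat W)
  encode F = (pic (leftBlock w₁ F) , pic (shift w₁ F)) , (pic (crossingLow w₁ F) , pic (crossingHigh w₁ F))
  maps-to : ∀ F → SupportedBelow n F → Fits H n F → ((K ⟨×⟩ K) ⟨×⟩ (K ⟨×⟩ K)) (encode F)
  maps-to F supported fits =
    (picture-kostant H W _ (leftBlock-fits F supported fits) ,
     picture-kostant H W _ (rightBlock-fits F supported fits)) ,
    (picture-kostant H W _ (crossingLow-fits F supported fits) ,
     picture-kostant H W _ (crossingHigh-fits F supported fits))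
  injective : ∀ F G → encode F ≡ encode G → Agree n F G
  injective F G eq =
    reflects F G (picture-injective H W (cong (proj₁ ∘ proj₁) eq))
                 (picture-injective H W (cong (proj₂ ∘ proj₁) eq))
                 (picture-injective H W (cong (proj₁ ∘ proj₂) eq))
                 (picture-injective H W (cong (proj₂ ∘ proj₂) eq))

partialSums : (ℕ → ℕ) → ℕ → ℕ
partialSums g t = ∑< (suc t) g

teslerRow : ℕ → Loops → ℕ → ℕ
teslerRow n a k = ∑[ i < n ] (if ⌊ k ≤? i ⌋ then a k i else 0)

teslerCol : ℕ → Loops → ℕ → ℕ
teslerCol n a k = ∑[ i < n ] strictUpper a i k

-- The entries of a Tesler matrix as a flow on the vertices 0, …, n: a i j runs from i to j for
-- i < j < n, and the diagonal entry a i i runs from i to n. The Kostant picture has the loop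
-- [i, j] for each unit of flow from i to j + 1.
teslerFlow : ℕ → Loops → Loops
teslerFlow n a i j = if ⌊ j <? n ⌋ then strictUpper a i j else (if ⌊ j ≟ n ⌋ then a i i else 0)

teslerToKostant : ℕ → Loops → Loops
teslerToKostant n a i j = if ⌊ j <? i ⌋ then 0 else teslerFlow n a i (suc j)

kostantToTesler : ℕ → Loops → Loops
kostantToTesler n c i j = if ⌊ j <? i ⌋ then 0 else (if ⌊ i ≟ j ⌋ then c i (pred n) else c i (pred j))

module _ (n : ℕ) (a : Loops) where

  private
    E : Loops
    E = teslerFlow n a

  strictUpper-teslerFlow : ∀ i {j} → j < n → strictUpper E i j ≡ strictUpper a i j
  strictUpper-teslerFlow i {j} j<n with <-≤-connex i j
  ... | inj₁ i<j = trans (strictUpper-above E i<j) (if-yes (j <? n) j<n)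
  ... | inj₂ j≤i = trans (strictUpper-below E j≤i) (sym (strictUpper-below a j≤i))

  rowSum-teslerFlow : ∀ {k} → k < n → rowSum (suc n) E k ≡ teslerRow n a k
  rowSum-teslerFlow {k} k<n = begin
    rowSum (suc n) E k                                ≡⟨ ∑<-suc n (strictUpper E k) ⟩
    ∑[ j < n ] strictUpper E k j + strictUpper E k n  ≡⟨ cong₂ _+_ (∑<-cong n (λ j → strictUpper-teslerFlow k))
                                                                   last ⟩
    ∑[ j < n ] strictUpper a k j + a k k              ≡⟨ cong (∑[ j < n ] strictUpper a k j +_) diagonal-sum ⟨
    ∑[ j < n ] strictUpper a k j + ∑< n diagonal      ≡⟨ ∑<-distrib-+ n (strictUpper a k) diagonal ⟨
    ∑[ j < n ] (strictUpper a k j + diagonal j)       ≡⟨ ∑<-cong n (λ j _ → split j) ⟩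
    teslerRow n a k                                   ∎
    where
    open ≡-Reasoning
    diagonal : ℕ → ℕ
    diagonal j = if ⌊ j ≟ k ⌋ then a k j else 0
    diagonal-sum : ∑< n diagonal ≡ a k k
    diagonal-sum = trans (∑<-single n diagonal k<n (λ j _ j≢k → if-no (j ≟ k) j≢k)) (if-yes (k ≟ k) refl)
    last : strictUpper E k n ≡ a k k
    last = trans (strictUpper-above E k<n) (trans (if-no (n <? n) (<-irrefl refl)) (if-yes (n ≟ n) refl))
    split : ∀ j → strictUpper a k j + diagonal j ≡ (if ⌊ k ≤? j ⌋ then a k j else 0)
    split j with <-cmp k j
    ... | tri< k<j _ _  = trans (cong₂ _+_ (strictUpper-above a k<j) (if-no (j ≟ k) (>⇒≢ k<j)))
                                (trans (+-identityʳ _) (sym (if-yes (k ≤? j) (<⇒≤ k<j))))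
    ... | tri≈ _ refl _ = trans (cong₂ _+_ (strictUpper-below a ≤-refl) (if-yes (k ≟ k) refl))
                                (sym (if-yes (k ≤? k) ≤-refl))
    ... | tri> _ _ j<k  = trans (cong₂ _+_ (strictUpper-below a (<⇒≤ j<k)) (if-no (j ≟ k) (<⇒≢ j<k)))
                                (sym (if-no (k ≤? j) (<⇒≱ j<k)))

  colSum-teslerFlow : ∀ {k} → k < n → colSum (suc n) E k ≡ teslerCol n a k
  colSum-teslerFlow {k} k<n = begin
    colSum (suc n) E k                                ≡⟨ ∑<-suc n (λ i → strictUpper E i k) ⟩
    ∑[ i < n ] strictUpper E i k + strictUpper E n k  ≡⟨ cong₂ _+_ (∑<-cong n (λ i _ →
                                                                     strictUpper-teslerFlow i k<n))
                                                                   (strictUpper-below E (<⇒≤ k<n)) ⟩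
    teslerCol n a k + 0                               ≡⟨ +-identityʳ _ ⟩
    teslerCol n a k                                   ∎
    where open ≡-Reasoning

  coverage-teslerToKostant : ∀ {t} → t < n → coverage n (teslerToKostant n a) t ≡ entering (suc n) E (suc t)
  coverage-teslerToKostant {t} t<n =
    trans (∑<-vanishing-tail _ t<n (λ i t<i _ → ∑<-zero n (λ b _ → through-left K i b t<i)))
          (∑<-cong (suc t) (λ i i≤t → ∑<-cong n (λ b _ → row i b (≤-pred i≤t))))
    where
    K : Loops
    K = teslerToKostant n a
    row : ∀ i b → i ≤ t → through t K i b ≡ (if ⌊ suc t ≤? suc b ⌋ then E i (suc b) else 0)
    row i b i≤t with ≤-<-connex t b
    ... | inj₁ t≤b = trans (through-inside K i≤t t≤b)
                     (trans (if-no (b <? i) (≤⇒≯ (≤-trans i≤t t≤b))) (sym (if-yes (suc t ≤? suc b) (s≤s t≤b))))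
    ... | inj₂ b<t = trans (through-right K i b b<t) (sym (if-no (suc t ≤? suc b) (<⇒≱ (s≤s b<t))))

  coverage+teslerCols : ∀ {t} → t < n →
    coverage n (teslerToKostant n a) t + ∑< (suc t) (teslerCol n a) ≡ ∑< (suc t) (teslerRow n a)
  coverage+teslerCols {t} t<n = begin
    coverage n (teslerToKostant n a) t + ∑< (suc t) (teslerCol n a)
      ≡⟨ cong₂ _+_ (coverage-teslerToKostant t<n)
                   (∑<-cong (suc t) (λ k k≤t → sym (colSum-teslerFlow (<-≤-trans k≤t t<n)))) ⟩
    entering (suc n) E (suc t) + ∑< (suc t) (colSum (suc n) E)
      ≡⟨ flow-cut (suc n) E (suc t) (s≤s (<⇒≤ t<n)) ⟨
    ∑< (suc t) (rowSum (suc n) E)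
      ≡⟨ ∑<-cong (suc t) (λ k k≤t → rowSum-teslerFlow (<-≤-trans k≤t t<n)) ⟩
    ∑< (suc t) (teslerRow n a)
      ∎
    where open ≡-Reasoning

  balanced⇔covered : ∀ g →
    (∀ k → k < n → teslerRow n a k ≡ teslerCol n a k + g k) ⇔
    (∀ t → t < n → coverage n (teslerToKostant n a) t ≡ partialSums g t)
  balanced⇔covered g = mk⇔ covered balanced
    where
    R C cov : ℕ → ℕ
    R   = teslerRow n a
    C   = teslerCol n a
    cov = coverage n (teslerToKostant n a)
    covered : (∀ k → k < n → R k ≡ C k + g k) → ∀ t → t < n → cov t ≡ partialSums g t
    covered balance t t<n = +-cancelˡ-≡ (∑< (suc t) C) _ _ (begin
      ∑< (suc t) C + cov t            ≡⟨ +-comm _ (cov t) ⟩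
      cov t + ∑< (suc t) C            ≡⟨ coverage+teslerCols t<n ⟩
      ∑< (suc t) R                    ≡⟨ ∑<-cong (suc t) (λ k k≤t → balance k (<-≤-trans k≤t t<n)) ⟩
      ∑[ k < suc t ] (C k + g k)      ≡⟨ ∑<-distrib-+ (suc t) C g ⟩
      ∑< (suc t) C + partialSums g t  ∎)
      where open ≡-Reasoning
    balanced : (∀ t → t < n → cov t ≡ partialSums g t) → ∀ k → k < n → R k ≡ C k + g k
    balanced covers = ∑<-prefixes-injective n (λ t t<n → begin
      ∑< (suc t) R                    ≡⟨ coverage+teslerCols t<n ⟨
      cov t + ∑< (suc t) C            ≡⟨ cong (_+ ∑< (suc t) C) (covers t t<n) ⟩
      partialSums g t + ∑< (suc t) C  ≡⟨ +-comm _ (∑< (suc t) C) ⟩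
      ∑< (suc t) C + ∑< (suc t) g     ≡⟨ ∑<-distrib-+ (suc t) C g ⟨
      ∑[ k < suc t ] (C k + g k)      ∎)
      where open ≡-Reasoning

pos-minus-pos≡pos⇔ : ∀ m n k → (pos m - pos n ≡ pos k) ⇔ (m ≡ n + k)
pos-minus-pos≡pos⇔ m n k = mk⇔ to from
  where
  to : pos m - pos n ≡ pos k → m ≡ n + k
  to eq = trans (ℤ.+-injective (begin
    pos m                            ≡⟨ ℤ.+-identityʳ (pos m) ⟨
    pos m ℤ.+ pos 0                  ≡⟨ cong (λ i → pos m ℤ.+ i) (ℤ.+-inverseˡ (pos n)) ⟨
    pos m ℤ.+ (ℤ.- pos n ℤ.+ pos n)  ≡⟨ ℤ.+-assoc (pos m) (ℤ.- pos n) (pos n) ⟨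
    pos m - pos n ℤ.+ pos n          ≡⟨ cong (λ i → i ℤ.+ pos n) eq ⟩
    pos (k + n)                      ∎)) (+-comm k n)
    where open ≡-Reasoning
  from : m ≡ n + k → pos m - pos n ≡ pos k
  from refl = trans (ℤ.[+m]-[+n]≡m⊖n (n + k) n) (trans (ℤ.⊖-≥ (m≤m+n n k)) (cong pos (m+n∸m≡n n k)))

module TeslerKostant (n : ℕ) (g : ℕ → ℕ) where

  hooks : Fin n → ℤ
  hooks k = pos (g (toℕ k))

  toKostant : Mat n → Mat n
  toKostant A = matFrom n n (teslerToKostant n (matAt A))

  toTesler : Mat n → Mat n
  toTesler C = matFrom n n (kostantToTesler n (matAt C))

  hookSum≡ : ∀ A k → hookSum A k ≡ pos (teslerRow n (matAt A) (toℕ k)) - pos (teslerCol n (matAt A) (toℕ k))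
  hookSum≡ A k = cong₂ (λ r c → pos r - pos c)
    (ΣFin≡∑< n _ (λ i → cong (λ x → if ⌊ toℕ k ≤? toℕ i ⌋ then x else 0) (matAt-entry A k i)))
    (ΣFin≡∑< n _ (λ i → cong (λ x → if ⌊ toℕ i <? toℕ k ⌋ then x else 0) (matAt-entry A i k)))

  hooks⇔balanced : ∀ A → (∀ k → hookSum A k ≡ hooks k) ⇔
                         (∀ k → k < n → teslerRow n (matAt A) k ≡ teslerCol n (matAt A) k + g k)
  hooks⇔balanced A = mk⇔
    (λ hooks≡ → ∀-Fin⇒∀-< (λ k → teslerRow n (matAt A) k ≡ teslerCol n (matAt A) k + g k) (λ k →
                  Equivalence.to (pos-minus-pos≡pos⇔ _ _ _) (trans (sym (hookSum≡ A k)) (hooks≡ k))))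
    (λ balance k →
       trans (hookSum≡ A k) (Equivalence.from (pos-minus-pos≡pos⇔ _ _ _) (balance (toℕ k) (toℕ<n k))))

  coverage-toKostant : ∀ A {t} → t < n →
    coverage n (matAt (toKostant A)) t ≡ coverage n (teslerToKostant n (matAt A)) t
  coverage-toKostant A {t} t<n =
    coverage-cong n t (λ a b a≤t _ b<n → matAt-matFrom n n _ (≤-<-trans a≤t t<n) b<n)

  toKostant-upper : ∀ A → UpperTriangular (toKostant A)
  toKostant-upper A = matFrom-upperTriangular n _ (λ i j j<i → if-yes (j <? i) j<i)

  toTesler-upper : ∀ C → UpperTriangular (toTesler C)
  toTesler-upper C = matFrom-upperTriangular n _ (λ i j j<i → if-yes (j <? i) j<i)

  tesler⇒kostant : ∀ A → IsTesler hooks A → Kostant (partialSums g) n (toKostant A)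
  tesler⇒kostant A (_ , hooks≡) = toKostant-upper A , λ t → begin
    finCoverage (toKostant A) t                       ≡⟨ finCoverage≡coverage (toKostant A) t ⟩
    coverage n (matAt (toKostant A)) (toℕ t)          ≡⟨ coverage-toKostant A (toℕ<n t) ⟩
    coverage n (teslerToKostant n (matAt A)) (toℕ t)  ≡⟨ covered (toℕ t) (toℕ<n t) ⟩
    partialSums g (toℕ t)                             ∎
    where
    open ≡-Reasoning
    covered : ∀ t → t < n → coverage n (teslerToKostant n (matAt A)) t ≡ partialSums g t
    covered = Equivalence.to (balanced⇔covered n (matAt A) g) (Equivalence.to (hooks⇔balanced A) hooks≡)

  kostant⇒tesler : ∀ A → UpperTriangular A → Kostant (partialSums g) n (toKostant A) → IsTesler hooks A
  kostant⇒tesler A upper kostant = upper ,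
    Equivalence.from (hooks⇔balanced A) (Equivalence.from (balanced⇔covered n (matAt A) g) (λ t t<n →
      trans (sym (coverage-toKostant A t<n)) (kostant-coverage (toKostant A) (partialSums g) kostant t t<n)))

  private
    suc-pred-of-< : ∀ {i m} → i < m → suc (pred m) ≡ m
    suc-pred-of-< {m = suc _} _ = refl

  toTesler∘toKostant : ∀ A → UpperTriangular A → toTesler (toKostant A) ≡ A
  toTesler∘toKostant A upper =
    matAt-injective _ _ (λ i j i<n j<n → trans (matAt-matFrom n n _ i<n j<n) (entry-≡ i j i<n j<n))
    where
    a K : Loops
    a = matAt A
    K = matAt (toKostant A)
    K-at : ∀ {i j} → i ≤ j → j < n → K i j ≡ teslerFlow n a i (suc j)
    K-at i≤j j<n = trans (matAt-matFrom n n _ (≤-<-trans i≤j j<n) j<n) (if-no (_ <? _) (≤⇒≯ i≤j))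
    entry-≡ : ∀ i j → i < n → j < n → kostantToTesler n K i j ≡ a i j
    entry-≡ i j i<n j<n with <-cmp i j
    ... | tri> _ _ j<i  = trans (if-yes (j <? i) j<i) (sym (matAt-lower A upper i j j<i))
    ... | tri≈ _ refl _ = begin
      kostantToTesler n K i i          ≡⟨ trans (if-no (i <? i) (<-irrefl refl)) (if-yes (i ≟ i) refl) ⟩
      K i (pred n)                     ≡⟨ K-at (pred-mono-≤ i<n) (≤-reflexive (suc-pred-of-< i<n)) ⟩
      teslerFlow n a i (suc (pred n))  ≡⟨ cong (teslerFlow n a i) (suc-pred-of-< i<n) ⟩
      teslerFlow n a i n               ≡⟨ trans (if-no (n <? n) (<-irrefl refl)) (if-yes (n ≟ n) refl) ⟩
      a i i                            ∎
      where open ≡-Reasoning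
    ... | tri< i<j _ _  = begin
      kostantToTesler n K i j          ≡⟨ trans (if-no (j <? i) (<⇒≯ i<j)) (if-no (i ≟ j) (<⇒≢ i<j)) ⟩
      K i (pred j)                     ≡⟨ K-at (pred-mono-≤ i<j) (≤-<-trans pred[n]≤n j<n) ⟩
      teslerFlow n a i (suc (pred j))  ≡⟨ cong (teslerFlow n a i) (suc-pred-of-< i<j) ⟩
      teslerFlow n a i j               ≡⟨ trans (if-yes (j <? n) j<n) (strictUpper-above a i<j) ⟩
      a i j                            ∎
      where open ≡-Reasoning

  toKostant∘toTesler : ∀ C → UpperTriangular C → toKostant (toTesler C) ≡ C
  toKostant∘toTesler C upper =
    matAt-injective _ _ (λ i j i<n j<n → trans (matAt-matFrom n n _ i<n j<n) (entry-≡ i j i<n j<n))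
    where
    c T : Loops
    c = matAt C
    T = matAt (toTesler C)
    entry-≡ : ∀ i j → i < n → j < n → teslerToKostant n T i j ≡ c i j
    entry-≡ i j i<n j<n with <-≤-connex j i
    ... | inj₁ j<i = trans (if-yes (j <? i) j<i) (sym (matAt-lower C upper i j j<i))
    ... | inj₂ i≤j with <-≤-connex (suc j) n
    ...   | inj₁ 1+j<n = begin
      teslerToKostant n T i j        ≡⟨ trans (if-no (j <? i) (≤⇒≯ i≤j)) (if-yes (suc j <? n) 1+j<n) ⟩
      strictUpper T i (suc j)        ≡⟨ strictUpper-above T (s≤s i≤j) ⟩
      T i (suc j)                    ≡⟨ matAt-matFrom n n _ i<n 1+j<n ⟩
      kostantToTesler n c i (suc j)  ≡⟨ trans (if-no (suc j <? i) (≤⇒≯ (m≤n⇒m≤1+n i≤j)))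
                                              (if-no (i ≟ suc j) (<⇒≢ (s≤s i≤j))) ⟩
      c i j                          ∎
      where open ≡-Reasoning
    ...   | inj₂ n≤1+j = begin
      teslerToKostant n T i j        ≡⟨ trans (if-no (j <? i) (≤⇒≯ i≤j))
                                        (trans (if-no (suc j <? n) (≤⇒≯ n≤1+j)) (if-yes (suc j ≟ n) 1+j≡n)) ⟩
      T i i                          ≡⟨ matAt-matFrom n n _ i<n i<n ⟩
      kostantToTesler n c i i        ≡⟨ trans (if-no (i <? i) (<-irrefl refl)) (if-yes (i ≟ i) refl) ⟩
      c i (pred n)                   ≡⟨ cong (c i ∘ pred) 1+j≡n ⟨
      c i j                          ∎
      where
      open ≡-Reasoning
      1+j≡n : suc j ≡ n
      1+j≡n = ≤-antisym j<n n≤1+j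

teslerCard : ∀ n g → HasCard (IsTesler (λ k → pos (g (toℕ k)))) (#K (partialSums g) n)
teslerCard n g = HasCard-bijection (#K-card (partialSums g) n) toTesler toKostant
  (λ {C} kostant → kostant⇒tesler (toTesler C) (toTesler-upper C)
                     (subst (Kostant (partialSums g) n) (sym (toKostant∘toTesler C (proj₁ kostant))) kostant))
  (λ {A} → tesler⇒kostant A)
  (λ {C} kostant → toKostant∘toTesler C (proj₁ kostant))
  (λ {A} tesler → toTesler∘toKostant A (proj₁ tesler))
  where open TeslerKostant n g

#K-≤-power : ∀ {n} o w₂ h c {Y E} → suc o + w₂ ≡ n → suc o ≤ w₂ → Y ≤ suc c * h →
             (∀ t → t < suc w₂ → h ≤ E (o + t)) → #K (λ _ → Y) n ≤ #K E n ^ (4 * suc c)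
#K-≤-power {n} o w₂ h c {Y} {E} n≡ o<w₂ Y≤ h≤E = begin
  #K (λ _ → Y) n                       ≤⟨ #K-mono n (λ _ _ → Y≤) ⟩
  #K (λ _ → suc c * h) n               ≤⟨ #K-height-multiple c h n ⟩
  #K (λ _ → h) n ^ suc c               ≡⟨ cong (λ m → #K (λ _ → h) m ^ suc c) n≡ ⟨
  #K (λ _ → h) (suc o + w₂) ^ suc c    ≤⟨ ^-monoˡ-≤ (suc c) (#K-width-split h (s≤s o<w₂) ≤-refl
                                                                            (s≤s (m≤n+m w₂ o))) ⟩
  (#K (λ _ → h) (suc w₂) ^ 4) ^ suc c  ≤⟨ ^-monoˡ-≤ (suc c) (^-monoˡ-≤ 4 (#K-offset o (suc w₂) h≤E)) ⟩
  (#K E (o + suc w₂) ^ 4) ^ suc c      ≡⟨ cong (λ m → (#K E m ^ 4) ^ suc c) (trans (+-suc o w₂) n≡) ⟩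
  (#K E n ^ 4) ^ suc c                 ≡⟨ ^-*-assoc (#K E n) 4 (suc c) ⟩
  #K E n ^ (4 * suc c)                 ∎
  where open ≤-Reasoning

twice-partialSums-suc : ∀ k → 2 * partialSums suc k ≡ suc k * suc (suc k)
twice-partialSums-suc zero    = refl
twice-partialSums-suc (suc k) = begin
  2 * partialSums suc (suc k)              ≡⟨ cong (2 *_) (∑<-suc (suc k) suc) ⟩
  2 * (partialSums suc k + suc (suc k))    ≡⟨ *-distribˡ-+ 2 (partialSums suc k) _ ⟩
  2 * partialSums suc k + 2 * suc (suc k)  ≡⟨ cong (_+ 2 * suc (suc k)) (twice-partialSums-suc k) ⟩
  suc k * suc (suc k) + 2 * suc (suc k)    ≡⟨ gauss-step k ⟩
  suc (suc k) * suc (suc (suc k))          ∎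
  where
  open ≡-Reasoning
  gauss-step : ∀ k → suc k * suc (suc k) + 2 * suc (suc k) ≡ suc (suc k) * suc (suc (suc k))
  gauss-step = solve-∀

partialSums-one : ∀ t → partialSums (λ _ → 1) t ≡ suc t
partialSums-one t = trans (∑<-const (suc t) 1) (*-identityʳ (suc t))

module _ (k : ℕ) where

  private
    n o w₂ : ℕ
    n  = suc (suc k)
    o  = ⌊ k /2⌋
    w₂ = suc ⌈ k /2⌉

    n≡ : suc o + w₂ ≡ n
    n≡ = cong suc (trans (+-suc o ⌈ k /2⌉) (cong suc (⌊n/2⌋+⌈n/2⌉≡n k)))

    o<w₂ : suc o ≤ w₂
    o<w₂ = s≤s (⌊n/2⌋≤⌈n/2⌉ k)

    n≤ : n ≤ suc o + suc (suc o)
    n≤ = subst (_≤ suc o + suc (suc o)) n≡ (+-monoʳ-≤ (suc o) (s≤s (⌊n/2⌋-mono (n≤1+n (suc k)))))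

  #K-n²≤#K-triangular^40 : #K (λ _ → n * n) n ≤ #K (partialSums suc) n ^ 40
  #K-n²≤#K-triangular^40 =
    #K-≤-power o w₂ (partialSums suc o) 9 n≡ o<w₂ n²≤ (λ t _ → ∑<-mono-range suc (s≤s (m≤m+n o t)))
    where
    m : ℕ
    m = suc o + suc (suc o)
    square-identity : ∀ o → let m = suc o + suc (suc o) in
                      m * m + (o * o + 3 * o + 1) ≡ 5 * (suc o * suc (suc o))
    square-identity = solve-∀
    n²≤ : n * n ≤ 10 * partialSums suc o
    n²≤ = begin
      n * n                             ≤⟨ *-mono-≤ n≤ n≤ ⟩
      m * m                             ≤⟨ m≤m+n _ (o * o + 3 * o + 1) ⟩
      m * m + (o * o + 3 * o + 1)       ≡⟨ square-identity o ⟩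
      5 * (suc o * suc (suc o))         ≡⟨ cong (5 *_) (twice-partialSums-suc o) ⟨
      5 * (2 * partialSums suc o)       ≡⟨ *-assoc 5 2 (partialSums suc o) ⟨
      10 * partialSums suc o            ∎
      where open ≤-Reasoning

  #K-triangular≤#K-n² : #K (partialSums suc) n ≤ #K (λ _ → n * n) n
  #K-triangular≤#K-n² = #K-mono n (λ t t<n → begin
    ∑< (suc t) suc    ≤⟨ ∑<-mono (suc t) (λ i i<1+t → ≤-trans i<1+t t<n) ⟩
    ∑[ _ < suc t ] n  ≡⟨ ∑<-const (suc t) n ⟩
    suc t * n         ≤⟨ *-monoˡ-≤ n t<n ⟩
    n * n             ∎)
    where open ≤-Reasoning

  #K-n≤#K-naturals^12 : #K (λ _ → n) n ≤ #K (partialSums (λ _ → 1)) n ^ 12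
  #K-n≤#K-naturals^12 = #K-≤-power o w₂ (suc o) 2 n≡ o<w₂ n≤3[1+o] (λ t _ →
    subst (suc o ≤_) (sym (partialSums-one (o + t))) (s≤s (m≤m+n o t)))
    where
    triple-identity : ∀ o → suc o + suc (suc o) + o ≡ 3 * suc o
    triple-identity = solve-∀
    n≤3[1+o] : n ≤ 3 * suc o
    n≤3[1+o] = ≤-trans n≤ (subst (suc o + suc (suc o) ≤_) (triple-identity o) (m≤m+n _ o))

  #K-naturals≤#K-n : #K (partialSums (λ _ → 1)) n ≤ #K (λ _ → n) n
  #K-naturals≤#K-n = #K-mono n (λ t t<n → ≤-trans (≤-reflexive (partialSums-one t)) t<n)

lnAsymp-by-powers : ∀ {F G : ℕ → ℕ → Set} q →
  (∀ k → ∃[ X ] ∃[ Y ] (F (2 + k) X × G (2 + k) Y × Y ≤ X ^ suc q × X ≤ Y)) → LnAsymp F G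
lnAsymp-by-powers {F} {G} q bounds = 1 , suc q , 1 , 1 , s≤s z≤n , s≤s z≤n , s≤s z≤n , s≤s z≤n , 2 , at
  where
  at : ∀ n → 2 ≤ n → ∃[ X ] ∃[ Y ] (F n X × G n Y × Y ^ 1 ≤ X ^ suc q × X ^ 1 ≤ Y ^ 1)
  at (suc (suc k)) (s≤s (s≤s _)) with bounds k
  ... | X , Y , fX , gY , Y≤Xᑫ , X≤Y =
    X , Y , fX , gY , subst (_≤ X ^ suc q) (sym (*-identityʳ Y)) Y≤Xᑫ , *-monoˡ-≤ 1 X≤Y

proposition2p9 : LnAsymp (λ n X → TeslerCard n (hook123 n) X) (λ n Y → KostantCard n (constHeight (n * n) n) Y)
    × LnAsymp (λ n X → TeslerCard n (hookOnes n) X) (λ n Y → KostantCard n (constHeight n n) Y)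
proposition2p9 =
  lnAsymp-by-powers 39 (λ k → _ , _ , teslerCard (2 + k) suc , #K-card _ (2 + k) ,
                               #K-n²≤#K-triangular^40 k , #K-triangular≤#K-n² k) ,
  lnAsymp-by-powers 11 (λ k → _ , _ , teslerCard (2 + k) (λ _ → 1) , #K-card _ (2 + k) ,
                               #K-n≤#K-naturals^12 k , #K-naturals≤#K-n k)
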